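{- Let $L$ be a finitely algebraizable logic in the language $\tau$ with equivalent algebraic semantics $\mathcal{Q}$. Let $\Sigma$ and $\Sigma'$ be two sets of EFD-sentences in $\tau$. 1. The following are equivalent: (i) there is a $\tau$-morphism from $L^{\Sigma'}$ to $L^\Sigma$; (ii) there is a $\tau$-interpretation of $\mathcal{Q}^{\Sigma'}$ in $\mathcal{Q}^\Sigma$; (iii) $\mathcal{Q} \cap \mathrm{Mod}(\Sigma) \subseteq \mathcal{Q} \cap \mathrm{Mod}(\Sigma')$. 2. The following are equivalent: (i) $L^{\Sigma'}$ and $L^\Sigma$ are $\tau$-equipollent; (ii) $\mathcal{Q}^{\Sigma'}$ and $\mathcal{Q}^\Sigma$ are $\tau$-term-equivalent; (iii) $\mathcal{Q} \cap \mathrm{Mod}(\Sigma) = \mathcal{Q} \cap \mathrm{Mod}(\Sigma')$.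
   Context: An EFD-sentence in a language $\tau$ is a sentence $\varphi = \forall x_1\ldots x_n \exists! z_1\ldots z_m \bigwedge_{i=1}^k s_i(\bar x,\bar z)=t_i(\bar x,\bar z)$ with $s_i,t_i$ $\tau$-terms, $n\ge 0$, $m\ge1$; $U(\varphi)$ denotes the (quasi-identity) uniqueness part $\forall \bar x\bar y\bar z\,(\alpha(\bar x,\bar y)\wedge\alpha(\bar x,\bar z)\to \bar y=\bar z)$. For a quasivariety $\mathcal{Q}$ axiomatized by quasi-identities $\Gamma$ and a set $\Sigma$ of EFD-sentences, $\mathcal{Q}^\Sigma := \mathrm{Mod}(\Gamma\cup E_\Sigma\cup U_\Sigma)$ in the language $\tau_\Sigma$ obtained by adding, for each $\varphi\in\Sigma$, new $n$-ary symbols $f^\varphi_1,\dots,f^\varphi_m$, where $E_\Sigma$ consists of the identities $\forall\bar x\, s_i(\bar x,f^\varphi_1(\bar x),\dots,f^\varphi_m(\bar x))=t_i(\bar x,f^\varphi_1(\bar x),\dots,f^\varphi_m(\bar x))$ and $U_\Sigma=\{U(\varphi):\varphi\in\Sigma\}$. Logics are finitary structural consequence operators. If $L$ is algebraizable with equivalence formulas $\Delta(x,y)$ and $\Phi(\bar x,\bar z)$ is a finite set of formulas, $L^\Phi$ is the least logic containing $L$ with new $n$-ary symbols $f^\Phi_1,\dots,f^\Phi_m$ such that $\vdash \Phi(\bar x,f^\Phi_1(\bar x),\dots,f^\Phi_m(\bar x))$ and $\Phi(\bar x,\bar y),\Phi(\bar x,\bar z)\vdash \bigcup_j\Delta(y_j,z_j)$;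 $L^\Sigma$ for a set $\Sigma$ of EFD-sentences means the least logic containing $L^{\Phi}$ for each $\Phi = \bigcup_i \Delta(s_i,t_i)$ with $\forall\bar x\exists!\bar z\bigwedge_i s_i=t_i\in\Sigma$. For expansions $\tau_1,\tau_2$ of $\tau$, a $\tau$-translation is a map $T$ sending each $n$-ary symbol of $\tau_1$ to a $\tau_2$-term in $x_1,\dots,x_n$ with $T(f)=f(x_1,\dots,x_n)$ for $f\in\tau$ (extended to all terms). A $\tau$-interpretation of a class $\mathcal{K}_1$ in $\mathcal{K}_2$ is a $\tau$-translation $T$ with $\mathbf{A}^T:=(A,\{T(f)^{\mathbf{A}}:f\in\tau_1\})\in\mathcal{K}_1$ for all $\mathbf{A}\in\mathcal{K}_2$; $\mathcal{K}_1,\mathcal{K}_2$ are $\tau$-term-equivalent if there are mutually inverse such interpretations. A $\tau$-morphism from $L_1$ to $L_2$ is a $\tau$-translation $T$ with $\Gamma\vdash_{L_1}\varphi$ implying $T(\Gamma)\vdash_{L_2}T(\varphi)$; $L_1,L_2$ are $\tau$-equipollent if there are $\tau$-morphisms $T$, $S$ both ways with $\varphi\dashv\vdash_{L_1}S(T(\varphi))$ and $\varphi\dashv\vdash_{L_2}T(S(\varphi))$ for all formulas. -}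

module Defs where

open import Level using (0ℓ)
open import Data.Nat using (ℕ; zero; suc; _+_; _≤_)
open import Data.Fin using (Fin; zero; suc; toℕ)
open import Data.Vec using (Vec; []; _∷_; lookup; tabulate)
open import Data.List using (List; []; _∷_; map; concatMap; _++_)
open import Data.List.Membership.Propositional using (_∈_)
open import Data.List.Relation.Unary.All using (All)
open import Data.Product using (Σ; Σ-syntax; ∃; _×_; _,_; proj₁; proj₂)
open import Data.Sum using (_⊎_; inj₁; inj₂; [_,_])
open import Function using (_∘_; const)
open import Relation.Binary using (IsEquivalence)
open import Relation.Binary.PropositionalEquality using (_≡_)
open import Relation.Unary using (Pred)

record Signature : Set₁ where
  field
    Sym : Set
    ar  : Sym → ℕ
open Signature public

data Term (τ : Signature) (X : Set) : Set where
  var : X → Term τ X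
  op  : (f : Sym τ) → Vec (Term τ X) (ar τ f) → Term τ X

module _ {τ : Signature} where
  mutual
    sub : ∀ {X Y} → (X → Term τ Y) → Term τ X → Term τ Y
    sub σ (var x)   = σ x
    sub σ (op f ts) = op f (sub* σ ts)

    sub* : ∀ {X Y n} → (X → Term τ Y) → Vec (Term τ X) n → Vec (Term τ Y) n
    sub* σ []       = []
    sub* σ (t ∷ ts) = sub σ t ∷ sub* σ ts

Fm : Signature → Set
Fm τ = Term τ ℕ

Eqn : Signature → Set → Set
Eqn τ X = Term τ X × Term τ X

image : ∀ {A B : Set} → (A → B) → Pred A 0ℓ → Pred B 0ℓ
image f Γ y = ∃ λ x → Γ x × f x ≡ y

⟪_⟫ : ∀ {A : Set} → List A → Pred A 0ℓ
⟪ xs ⟫ x = x ∈ xs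

｛_｝ : ∀ {A : Set} → A → Pred A 0ℓ
｛ a ｝ x = x ≡ a

pair : ∀ {A : Set} → A → A → Fin 2 → A
pair a b zero       = a
pair a b (suc zero) = b

record Expansion (τ : Signature) : Set₁ where
  field
    New : Set
    arN : New → ℕ
open Expansion public

sig : ∀ {τ} → Expansion τ → Signature
sig {τ} E = record { Sym = Sym τ ⊎ New E ; ar = [ ar τ , arN E ] }

module _ {τ : Signature} {E : Expansion τ} where
  mutual
    emb : ∀ {X} → Term τ X → Term (sig E) X
    emb (var x)   = var x
    emb (op f ts) = op (inj₁ f) (emb* ts)

    emb* : ∀ {X n} → Vec (Term τ X) n → Vec (Term (sig E) X) n
    emb* []       = []
    emb* (t ∷ ts) = emb t ∷ emb* ts

-- A τ-translation from τ₁ = sig E₁ to τ₂ = sig E₂: symbols of τ are sent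
-- to themselves (built in), each new n-ary symbol to a τ₂-term in x₁…xₙ.
Translation : ∀ {τ} → Expansion τ → Expansion τ → Set
Translation E₁ E₂ = (g : New E₁) → Term (sig E₂) (Fin (arN E₁ g))

module _ {τ : Signature} {E₁ E₂ : Expansion τ} (T : Translation E₁ E₂) where
  mutual
    trans : ∀ {X} → Term (sig E₁) X → Term (sig E₂) X
    trans (var x)          = var x
    trans (op (inj₁ f) ts) = op (inj₁ f) (trans* ts)
    trans (op (inj₂ g) ts) = sub (lookup (trans* ts)) (T g)

    trans* : ∀ {X n} → Vec (Term (sig E₁) X) n → Vec (Term (sig E₂) X) n
    trans* []       = []
    trans* (t ∷ ts) = trans t ∷ trans* ts

record Algebra (τ : Signature) : Set₁ where
  field
    Carrier : Set
    _≈_     : Carrier → Carrier → Set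
    isEquiv : IsEquivalence _≈_
    ⟦_⟧     : (f : Sym τ) → (Fin (ar τ f) → Carrier) → Carrier
    ⟦⟧-cong : ∀ f {as bs : Fin (ar τ f) → Carrier} →
              (∀ i → as i ≈ bs i) → ⟦ f ⟧ as ≈ ⟦ f ⟧ bs

module _ {τ : Signature} (A : Algebra τ) where
  open Algebra A
  mutual
    eval : ∀ {X} → (X → Carrier) → Term τ X → Carrier
    eval ρ (var x)   = ρ x
    eval ρ (op f ts) = ⟦ f ⟧ (eval* ρ ts)

    eval* : ∀ {X n} → (X → Carrier) → Vec (Term τ X) n → Fin n → Carrier
    eval* ρ (t ∷ ts) zero    = eval ρ t
    eval* ρ (t ∷ ts) (suc i) = eval* ρ ts i

  mutual
    eval-cong : ∀ {X} {ρ ρ' : X → Carrier} → (∀ x → ρ x ≈ ρ' x) →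
                ∀ t → eval ρ t ≈ eval ρ' t
    eval-cong p (var x)   = p x
    eval-cong p (op f ts) = ⟦⟧-cong f (eval*-cong p ts)

    eval*-cong : ∀ {X n} {ρ ρ' : X → Carrier} → (∀ x → ρ x ≈ ρ' x) →
                 (ts : Vec (Term τ X) n) → ∀ i → eval* ρ ts i ≈ eval* ρ' ts i
    eval*-cong p (t ∷ ts) zero    = eval-cong p t
    eval*-cong p (t ∷ ts) (suc i) = eval*-cong p ts i

  Holds : ∀ {X} → (X → Carrier) → Eqn τ X → Set
  Holds ρ e = eval ρ (proj₁ e) ≈ eval ρ (proj₂ e)

reduct : ∀ {τ} {E : Expansion τ} → Algebra (sig E) → Algebra τ
reduct B = record
  { Carrier = Carrier ; _≈_ = _≈_ ; isEquiv = isEquiv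
  ; ⟦_⟧ = λ f → ⟦ inj₁ f ⟧ ; ⟦⟧-cong = λ f → ⟦⟧-cong (inj₁ f) }
  where open Algebra B

_^_ : ∀ {τ} {E₁ E₂ : Expansion τ} → Algebra (sig E₂) → Translation E₁ E₂ →
      Algebra (sig E₁)
_^_ {τ} {E₁} {E₂} A T = record
  { Carrier = Carrier ; _≈_ = _≈_ ; isEquiv = isEquiv ; ⟦_⟧ = ops ; ⟦⟧-cong = opsc }
  where
  open Algebra A
  ops : (f : Sym (sig E₁)) → (Fin (ar (sig E₁) f) → Carrier) → Carrier
  ops (inj₁ f) as = ⟦ inj₁ f ⟧ as
  ops (inj₂ g) as = eval A as (T g)
  opsc : ∀ f {as bs} → (∀ i → as i ≈ bs i) → ops f as ≈ ops f bs
  opsc (inj₁ f) p = ⟦⟧-cong (inj₁ f) p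
  opsc (inj₂ g) p = eval-cong A p (T g)

Class : Signature → Set₁
Class τ = Pred (Algebra τ) 0ℓ

IsInterpretation : ∀ {τ} {E₁ E₂ : Expansion τ} → Translation E₁ E₂ →
                   Class (sig E₁) → Class (sig E₂) → Set₁
IsInterpretation T K₁ K₂ = ∀ A → K₂ A → K₁ (A ^ T)

IsInverseOn : ∀ {τ} {E₁ E₂ : Expansion τ} → Translation E₁ E₂ →
              Translation E₂ E₁ → Algebra (sig E₂) → Set
IsInverseOn {E₂ = E₂} T S A = ∀ f (as : Fin (ar (sig E₂) f) → Carrier) →
                    Algebra.⟦_⟧ ((A ^ T) ^ S) f as ≈ ⟦ f ⟧ as
  where open Algebra A

TermEquivalent : ∀ {τ} {E₁ E₂ : Expansion τ} → Class (sig E₁) → Class (sig E₂) → Set₁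
TermEquivalent {E₁ = E₁} {E₂} K₁ K₂ =
  Σ[ T ∈ Translation E₁ E₂ ] Σ[ S ∈ Translation E₂ E₁ ]
    IsInterpretation T K₁ K₂ × IsInterpretation S K₂ K₁ ×
    (∀ A → K₂ A → IsInverseOn T S A) × (∀ B → K₁ B → IsInverseOn S T B)

record QuasiId (τ : Signature) : Set where
  field
    hyps  : List (Eqn τ ℕ)
    concl : Eqn τ ℕ

SatQ : ∀ {τ} → Algebra τ → QuasiId τ → Set
SatQ A q = ∀ ρ → All (Holds A ρ) (QuasiId.hyps q) → Holds A ρ (QuasiId.concl q)

ModQ : ∀ {τ} → Pred (QuasiId τ) 0ℓ → Class τ
ModQ Γ A = ∀ q → Γ q → SatQ A q

-- EFD-sentences  ∀ x₁…xₙ ∃! z₁…zₘ ⋀ᵢ sᵢ(x̄,z̄) = tᵢ(x̄,z̄)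
-- (variables: inj₁ i is x_i, inj₂ j is z_j; the list holds the pairs (sᵢ,tᵢ))

record EFD (τ : Signature) : Set where
  field
    n m  : ℕ
    m≥1  : 1 ≤ m
    eqs  : List (Eqn τ (Fin n ⊎ Fin m))
open EFD public

SatEFD : ∀ {τ} (A : Algebra τ) (φ : EFD τ) →
         (Fin (n φ) → Algebra.Carrier A) → (Fin (m φ) → Algebra.Carrier A) → Set
SatEFD A φ a c = All (Holds A [ a , c ]) (eqs φ)

_⊨EFD_ : ∀ {τ} → Algebra τ → EFD τ → Set
A ⊨EFD φ = ∀ a → Σ[ c ∈ (Fin (m φ) → Carrier) ]
             (SatEFD A φ a c × (∀ c' → SatEFD A φ a c' → ∀ j → c j ≈ c' j))
  where open Algebra A

ModΣ : ∀ {τ} → Pred (EFD τ) 0ℓ → Class τ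
ModΣ Sg A = ∀ φ → Sg φ → A ⊨EFD φ

ExpΣ : ∀ {τ} → Pred (EFD τ) 0ℓ → Expansion τ
ExpΣ {τ} Sg = record { New = Σ[ φ ∈ EFD τ ] (Sg φ × Fin (m φ)) ; arN = λ g → n (proj₁ g) }

-- 𝒬^Σ = Mod(Γ ∪ E_Σ ∪ U_Σ)
QΣ : ∀ {τ} → Pred (QuasiId τ) 0ℓ → (Sg : Pred (EFD τ) 0ℓ) → Class (sig (ExpΣ Sg))
QΣ Γ Sg B =
  ModQ Γ (reduct B) ×
  (∀ φ (p : Sg φ) a → SatEFD (reduct B) φ a (λ j → ⟦ inj₂ (φ , p , j) ⟧ a)) ×
  (∀ φ → Sg φ → ∀ a c c' → SatEFD (reduct B) φ a c → SatEFD (reduct B) φ a c' →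
     ∀ j → c j ≈ c' j)
  where open Algebra B

record Logic (τ : Signature) : Set₁ where
  field
    _⊢_        : Pred (Fm τ) 0ℓ → Fm τ → Set
    reflexive  : ∀ {Γ φ} → Γ φ → Γ ⊢ φ
    monotone   : ∀ {Γ Δ φ} → (∀ ψ → Γ ψ → Δ ψ) → Γ ⊢ φ → Δ ⊢ φ
    cut        : ∀ {Γ Δ φ} → (∀ ψ → Δ ψ → Γ ⊢ ψ) → Δ ⊢ φ → Γ ⊢ φ
    structural : ∀ {Γ φ} (σ : ℕ → Fm τ) → Γ ⊢ φ → image (sub σ) Γ ⊢ sub σ φ
    finitary   : ∀ {Γ φ} → Γ ⊢ φ → Σ[ Γ₀ ∈ List (Fm τ) ] (All Γ Γ₀ × ⟪ Γ₀ ⟫ ⊢ φ)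

module _ {τ : Signature} where
  Δ⟨_,_⟩ : List (Term τ (Fin 2)) → Fm τ → Fm τ → List (Fm τ)
  Δ⟨ Δ , s ⟩ t = map (sub (pair s t)) Δ

  E⟨_,_⟩ : Pred (Eqn τ (Fin 1)) 0ℓ → Fm τ → Pred (Eqn τ ℕ) 0ℓ
  E⟨ E , φ ⟩ e = ∃ λ e₀ → E e₀ × e ≡ (sub (const φ) (proj₁ e₀) , sub (const φ) (proj₂ e₀))

  E[_,_] : Pred (Eqn τ (Fin 1)) 0ℓ → Pred (Fm τ) 0ℓ → Pred (Eqn τ ℕ) 0ℓ
  E[ E , Γ ] e = ∃ λ ψ → Γ ψ × E⟨ E , ψ ⟩ e

  _⊨[_]_ : Pred (Eqn τ ℕ) 0ℓ → Class τ → Eqn τ ℕ → Set₁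
  Θ ⊨[ K ] e = ∀ A → K A → ∀ ρ → (∀ e' → Θ e' → Holds A ρ e') → Holds A ρ e

-- L is (finitely) algebraizable with equivalent algebraic semantics K,
-- witnessed by Δ and E: conditions (A1) and (A4) of Blok–Pigozzi.
IsAlgebraizable : ∀ {τ} → Logic τ → Class τ → List (Term τ (Fin 2)) →
                  Pred (Eqn τ (Fin 1)) 0ℓ → Set₁
IsAlgebraizable {τ} L K Δ E =
  (∀ Γ φ → (Γ ⊢ φ → ∀ e → E⟨ E , φ ⟩ e → E[ E , Γ ] ⊨[ K ] e) ×
           ((∀ e → E⟨ E , φ ⟩ e → E[ E , Γ ] ⊨[ K ] e) → Γ ⊢ φ)) ×
  (∀ e → E[ E , ⟪ Δ⟨ Δ , x ⟩ y ⟫ ] e → ｛ (x , y) ｝ ⊨[ K ] e) ×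
  (E[ E , ⟪ Δ⟨ Δ , x ⟩ y ⟫ ] ⊨[ K ] (x , y))
  where
  open Logic L
  x y : Fm τ
  x = var 0
  y = var 1

-- The logic L^Σ (least logic in τ_Σ containing L and the L^Φ's),
-- given as the closure under substitution instances of its rules.

module _ {τ : Signature} (L : Logic τ) (Δ : List (Term τ (Fin 2)))
         (Sg : Pred (EFD τ) 0ℓ) where
  private
    S : Signature
    S = sig (ExpΣ Sg)
    open Logic L

  ΔΣ⟨_,_⟩ : Fm S → Fm S → List (Fm S)
  ΔΣ⟨ s , t ⟩ = map (sub (pair s t) ∘ emb) Δ

  Φ⟨_,_⟩ : (φ : EFD τ) → (Fin (n φ) ⊎ Fin (m φ) → Fm S) → List (Fm S)
  Φ⟨ φ , ρ ⟩ = concatMap (λ e → ΔΣ⟨ sub ρ (emb (proj₁ e)) , sub ρ (emb (proj₂ e)) ⟩) (eqs φ)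

  xv : ∀ {k} → Fin k → Fm S
  xv i = var (toℕ i)

  ρf : (φ : EFD τ) → Sg φ → Fin (n φ) ⊎ Fin (m φ) → Fm S
  ρf φ p (inj₁ i) = xv i
  ρf φ p (inj₂ j) = op (inj₂ (φ , p , j)) (tabulate xv)

  yv zv : (φ : EFD τ) → Fin (m φ) → Fm S
  yv φ j = var (n φ + toℕ j)
  zv φ j = var (n φ + m φ + toℕ j)

  ρy ρz : (φ : EFD τ) → Fin (n φ) ⊎ Fin (m φ) → Fm S
  ρy φ = [ xv , yv φ ]
  ρz φ = [ xv , zv φ ]

  data RuleΣ : List (Fm S) → Fm S → Set where
    base   : ∀ ps₀ c₀ → ⟪ ps₀ ⟫ ⊢ c₀ → RuleΣ (map emb ps₀) (emb c₀)
    exist  : ∀ φ (p : Sg φ) {χ} → χ ∈ Φ⟨ φ , ρf φ p ⟩ → RuleΣ [] χ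
    unique : ∀ φ → Sg φ → ∀ j {χ} → χ ∈ ΔΣ⟨ yv φ j , zv φ j ⟩ →
             RuleΣ (Φ⟨ φ , ρy φ ⟩ ++ Φ⟨ φ , ρz φ ⟩) χ

  data _⊢Σ_ (Γ : Pred (Fm S) 0ℓ) : Fm S → Set where
    hyp  : ∀ {φ} → Γ φ → Γ ⊢Σ φ
    rule : ∀ {ps c} → RuleΣ ps c → (σ : ℕ → Fm S) →
           All (λ q → Γ ⊢Σ sub σ q) ps → Γ ⊢Σ sub σ c

IsMorphism : ∀ {τ} {E₁ E₂ : Expansion τ} → Translation E₁ E₂ →
             (Pred (Fm (sig E₁)) 0ℓ → Fm (sig E₁) → Set) →
             (Pred (Fm (sig E₂)) 0ℓ → Fm (sig E₂) → Set) → Set₁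
IsMorphism T ⊢₁ ⊢₂ = ∀ Γ φ → ⊢₁ Γ φ → ⊢₂ (image (trans T) Γ) (trans T φ)

Equipollent : ∀ {τ} {E₁ E₂ : Expansion τ} →
              (Pred (Fm (sig E₁)) 0ℓ → Fm (sig E₁) → Set) →
              (Pred (Fm (sig E₂)) 0ℓ → Fm (sig E₂) → Set) → Set₁
Equipollent {E₁ = E₁} {E₂} ⊢₁ ⊢₂ =
  Σ[ T ∈ Translation E₁ E₂ ] Σ[ S ∈ Translation E₂ E₁ ]
    IsMorphism T ⊢₁ ⊢₂ × IsMorphism S ⊢₂ ⊢₁ ×
    (∀ φ → ⊢₁ ｛ φ ｝ (trans S (trans T φ)) × ⊢₁ ｛ trans S (trans T φ) ｝ φ) ×
    (∀ φ → ⊢₂ ｛ φ ｝ (trans T (trans S φ)) × ⊢₂ ｛ trans T (trans S φ) ｝ φ)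

QMod : ∀ {τ} → Pred (QuasiId τ) 0ℓ → Pred (EFD τ) 0ℓ → Class τ
QMod Γ Sg A = ModQ Γ A × ModΣ Sg A

_⊆K_ : ∀ {τ} → Class τ → Class τ → Set₁
K ⊆K K' = ∀ A → K A → K' A

module Submission where

-- From algebraizability we
-- derive that L is sound and complete for 𝒬 (through the defining
-- equations E) and that Δ(x,y) detects equality, so every quasi-identity
-- valid in 𝒬 becomes a rule of L.  For L^Σ this yields the Lindenbaum
-- congruence  s ~ t := Θ ⊢ Δ(s,t), whose quotient (the term algebra with
-- ~ as equality) lies in 𝒬^Σ; conversely L^Σ is sound for 𝒬^Σ.
-- The theorem then follows from four facts: a morphism is an
-- interpretation (soundness of L^Σ for the translated rules of L^Σ'), an
-- interpretation gives the inclusion of model classes, the inclusion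
-- gives a morphism (each new symbol of Σ' is defined by the unique
-- solution in the Lindenbaum algebra of L^Σ), and interpretations in
-- both directions are automatically inverse (uniqueness in U_Σ),
-- which is also what makes the associated morphisms an equipollence.

open import Defs
open import Level using (0ℓ)
open import Data.Nat using (ℕ; zero; suc; _+_)
open import Data.Nat.Properties using (+-assoc)
open import Data.Fin using (Fin; zero; suc; toℕ; fromℕ<)
open import Data.Vec using (Vec; []; _∷_; lookup; tabulate)
open import Data.Vec.Properties using (tabulate-cong; tabulate∘lookup; lookup∘tabulate)
open import Data.List using (List; []; _∷_; map; concatMap; _++_; allFin)
open import Data.List.Membership.Propositional using (_∈_; find; lose)
open import Data.List.Membership.Propositional.Properties using (∈-map⁺; ∈-map⁻; ∈-concatMap⁺; ∈-concatMap⁻; ∈-++⁻; ∈-++⁺ˡ; ∈-++⁺ʳ; ∈-allFin)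
open import Data.List.Relation.Unary.Any using (here; there)
open import Data.List.Relation.Unary.All as All using (All; []; _∷_)
open import Data.Product using (Σ-syntax; ∃; _×_; _,_; proj₁; proj₂)
open import Data.Sum using (_⊎_; inj₁; inj₂; [_,_])
open import Data.Empty using (⊥)
open import Function using (_∘_; const)
open import Function.Bundles using (_⇔_; mk⇔)
open import Relation.Binary using (IsEquivalence)
open import Relation.Unary using (Pred)
open import Relation.Binary.PropositionalEquality using (_≡_; refl; cong; cong₂; subst; subst₂) renaming (sym to ≡-sym; trans to ≡-trans)
open import Relation.Binary.PropositionalEquality.Properties using (module ≡-Reasoning)

module _ {τ : Signature} where
  mutual
    sub-cong : ∀ {X Y} {σ σ' : X → Term τ Y} → (∀ x → σ x ≡ σ' x) → ∀ t → sub σ t ≡ sub σ' t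
    sub-cong p (var x)   = p x
    sub-cong p (op f ts) = cong (op f) (sub*-cong p ts)

    sub*-cong : ∀ {X Y n} {σ σ' : X → Term τ Y} → (∀ x → σ x ≡ σ' x) →
                (ts : Vec (Term τ X) n) → sub* σ ts ≡ sub* σ' ts
    sub*-cong p []       = refl
    sub*-cong p (t ∷ ts) = cong₂ _∷_ (sub-cong p t) (sub*-cong p ts)

  mutual
    sub-sub : ∀ {X Y Z} (σ : Y → Term τ Z) (π : X → Term τ Y) t → sub σ (sub π t) ≡ sub (sub σ ∘ π) t
    sub-sub σ π (var x)   = refl
    sub-sub σ π (op f ts) = cong (op f) (sub*-sub σ π ts)

    sub*-sub : ∀ {X Y Z n} (σ : Y → Term τ Z) (π : X → Term τ Y) (ts : Vec (Term τ X) n) →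
               sub* σ (sub* π ts) ≡ sub* (sub σ ∘ π) ts
    sub*-sub σ π []       = refl
    sub*-sub σ π (t ∷ ts) = cong₂ _∷_ (sub-sub σ π t) (sub*-sub σ π ts)

  mutual
    sub-var : ∀ {X} (t : Term τ X) → sub var t ≡ t
    sub-var (var x)   = refl
    sub-var (op f ts) = cong (op f) (sub*-var ts)

    sub*-var : ∀ {X n} (ts : Vec (Term τ X) n) → sub* var ts ≡ ts
    sub*-var []       = refl
    sub*-var (t ∷ ts) = cong₂ _∷_ (sub-var t) (sub*-var ts)

  sub*-tabulate : ∀ {X Y n} (σ : X → Term τ Y) (g : Fin n → Term τ X) →
                  sub* σ (tabulate g) ≡ tabulate (sub σ ∘ g)
  sub*-tabulate {n = zero}  σ g = refl
  sub*-tabulate {n = suc n} σ g = cong (sub σ (g zero) ∷_) (sub*-tabulate σ (g ∘ suc))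

  lookup-sub* : ∀ {X Y n} (σ : X → Term τ Y) (ts : Vec (Term τ X) n) i →
                lookup (sub* σ ts) i ≡ sub σ (lookup ts i)
  lookup-sub* σ (t ∷ ts) zero    = refl
  lookup-sub* σ (t ∷ ts) (suc i) = lookup-sub* σ ts i

  sub-pair : ∀ {X Y} (σ : X → Term τ Y) (a b : Term τ X) (δ : Term τ (Fin 2)) →
             sub σ (sub (pair a b) δ) ≡ sub (pair (sub σ a) (sub σ b)) δ
  sub-pair σ a b δ = ≡-trans (sub-sub σ (pair a b) δ) (sub-cong pointwise δ)
    where
    pointwise : ∀ i → sub σ (pair a b i) ≡ pair (sub σ a) (sub σ b) i
    pointwise zero       = refl
    pointwise (suc zero) = refl

module _ {τ : Signature} {E : Expansion τ} where
  mutual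
    emb-sub : ∀ {X Y} (π : X → Term τ Y) t → emb {E = E} (sub π t) ≡ sub (emb ∘ π) (emb t)
    emb-sub π (var x)   = refl
    emb-sub π (op f ts) = cong (op (inj₁ f)) (emb*-sub π ts)

    emb*-sub : ∀ {X Y n} (π : X → Term τ Y) (ts : Vec (Term τ X) n) →
               emb* {E = E} (sub* π ts) ≡ sub* (emb ∘ π) (emb* ts)
    emb*-sub π []       = refl
    emb*-sub π (t ∷ ts) = cong₂ _∷_ (emb-sub π t) (emb*-sub π ts)

  emb*-tabulate : ∀ {X n} (g : Fin n → Term τ X) → emb* {E = E} (tabulate g) ≡ tabulate (emb ∘ g)
  emb*-tabulate {n = zero}  g = refl
  emb*-tabulate {n = suc n} g = cong (emb (g zero) ∷_) (emb*-tabulate (g ∘ suc))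

  emb-sub-pair : ∀ {X} (a b : Term τ X) (δ : Term τ (Fin 2)) →
                 emb {E = E} (sub (pair a b) δ) ≡ sub (pair (emb a) (emb b)) (emb δ)
  emb-sub-pair a b δ = ≡-trans (emb-sub (pair a b) δ) (sub-cong pointwise (emb δ))
    where
    pointwise : ∀ i → emb (pair a b i) ≡ pair (emb a) (emb b) i
    pointwise zero       = refl
    pointwise (suc zero) = refl

  sub*-emb-vars : ∀ {Y k} (σ : ℕ → Term (sig E) Y) (g : Fin k → ℕ) (us : Vec (Term (sig E) Y) k) →
                  (∀ i → σ (g i) ≡ lookup us i) → sub* σ (emb* (tabulate (var ∘ g))) ≡ us
  sub*-emb-vars σ g us values = begin
    sub* σ (emb* (tabulate (var ∘ g))) ≡⟨ cong (sub* σ) (emb*-tabulate (var ∘ g)) ⟩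
    sub* σ (tabulate (var ∘ g))         ≡⟨ sub*-tabulate σ (var ∘ g) ⟩
    tabulate (σ ∘ g)                    ≡⟨ tabulate-cong values ⟩
    tabulate (lookup us)                ≡⟨ tabulate∘lookup us ⟩
    us                                  ∎
    where open ≡-Reasoning

-- A τ-translation fixes τ-terms and commutes with substitution; the
-- latter is what makes translations of derivations again derivations.
module _ {τ : Signature} {E₁ E₂ : Expansion τ} (T : Translation E₁ E₂) where
  mutual
    trans-emb : ∀ {X} (t : Term τ X) → trans T (emb t) ≡ emb t
    trans-emb (var x)   = refl
    trans-emb (op f ts) = cong (op (inj₁ f)) (trans*-emb ts)

    trans*-emb : ∀ {X n} (ts : Vec (Term τ X) n) → trans* T (emb* ts) ≡ emb* ts
    trans*-emb []       = refl
    trans*-emb (t ∷ ts) = cong₂ _∷_ (trans-emb t) (trans*-emb ts)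

  lookup-trans* : ∀ {X n} (ts : Vec (Term (sig E₁) X) n) i → lookup (trans* T ts) i ≡ trans T (lookup ts i)
  lookup-trans* (t ∷ ts) zero    = refl
  lookup-trans* (t ∷ ts) (suc i) = lookup-trans* ts i

  mutual
    trans-sub : ∀ {X Y} (π : X → Term (sig E₁) Y) t → trans T (sub π t) ≡ sub (trans T ∘ π) (trans T t)
    trans-sub π (var x)          = refl
    trans-sub π (op (inj₁ f) ts) = cong (op (inj₁ f)) (trans*-sub π ts)
    trans-sub π (op (inj₂ g) ts) = begin
      sub (lookup (trans* T (sub* π ts))) (T g)           ≡⟨ sub-cong arguments (T g) ⟩
      sub (sub (trans T ∘ π) ∘ lookup (trans* T ts)) (T g) ≡⟨ ≡-sym (sub-sub (trans T ∘ π) (lookup (trans* T ts)) (T g)) ⟩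
      sub (trans T ∘ π) (sub (lookup (trans* T ts)) (T g)) ∎
      where
      open ≡-Reasoning
      arguments : ∀ i → lookup (trans* T (sub* π ts)) i ≡ sub (trans T ∘ π) (lookup (trans* T ts) i)
      arguments i = ≡-trans (cong (λ v → lookup v i) (trans*-sub π ts)) (lookup-sub* (trans T ∘ π) (trans* T ts) i)

    trans*-sub : ∀ {X Y n} (π : X → Term (sig E₁) Y) (ts : Vec (Term (sig E₁) X) n) →
                 trans* T (sub* π ts) ≡ sub* (trans T ∘ π) (trans* T ts)
    trans*-sub π []       = refl
    trans*-sub π (t ∷ ts) = cong₂ _∷_ (trans-sub π t) (trans*-sub π ts)

  trans-sub-emb : ∀ {X Y} (π : X → Term (sig E₁) Y) (t : Term τ X) →
                  trans T (sub π (emb t)) ≡ sub (trans T ∘ π) (emb t)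
  trans-sub-emb π t = ≡-trans (trans-sub π (emb t)) (cong (sub (trans T ∘ π)) (trans-emb t))

  trans-sub-pair : ∀ {X} (u v : Term (sig E₁) X) (δ : Term τ (Fin 2)) →
                   trans T (sub (pair u v) (emb δ)) ≡ sub (pair (trans T u) (trans T v)) (emb δ)
  trans-sub-pair u v δ = ≡-trans (trans-sub-emb (pair u v) δ) (sub-cong pointwise (emb δ))
    where
    pointwise : ∀ i → trans T (pair u v i) ≡ pair (trans T u) (trans T v) i
    pointwise zero       = refl
    pointwise (suc zero) = refl

-- `extend n f g` is the assignment of ℕ sending i < n to f i and n + k to
-- g k; it realises the variable conventions x̄, ȳ, z̄ of EFD-sentences.
extend : ∀ {A : Set} n → (Fin n → A) → (ℕ → A) → ℕ → A
extend zero    f g k       = g k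
extend (suc n) f g zero    = f zero
extend (suc n) f g (suc k) = extend n (f ∘ suc) g k

extend-toℕ : ∀ {A : Set} n (f : Fin n → A) g (i : Fin n) → extend n f g (toℕ i) ≡ f i
extend-toℕ (suc n) f g zero    = refl
extend-toℕ (suc n) f g (suc i) = extend-toℕ n (f ∘ suc) g i

extend-+ : ∀ {A : Set} n (f : Fin n → A) g k → extend n f g (n + k) ≡ g k
extend-+ zero    f g k = refl
extend-+ (suc n) f g k = extend-+ n (f ∘ suc) g k

sub*-extend-vars : ∀ {τ X k} (f : Fin k → Term τ X) g →
                   sub* (extend k f g) (tabulate (λ i → var (toℕ i))) ≡ tabulate f
sub*-extend-vars {k = k} f g = ≡-trans (sub*-tabulate (extend k f g) (λ i → var (toℕ i))) (tabulate-cong (extend-toℕ k f g))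

assign₃ : ∀ {A : Set} → A → A → A → ℕ → A
assign₃ a b c zero          = a
assign₃ a b c (suc zero)    = b
assign₃ a b c (suc (suc _)) = c

-- The assignment x̄ ↦ a, ȳ ↦ c, z̄ ↦ c' (with default d elsewhere) used to
-- instantiate the uniqueness rule U(φ) of an EFD-sentence.
extend₃ : ∀ {A : Set} N M → (Fin N → A) → (Fin M → A) → (Fin M → A) → A → ℕ → A
extend₃ N M a c c' d = extend N a (extend M c (extend M c' (const d)))

module _ {A : Set} N M (a : Fin N → A) (c c' : Fin M → A) (d : A) where
  extend₃-x : ∀ i → extend₃ N M a c c' d (toℕ i) ≡ a i
  extend₃-x = extend-toℕ N a _

  extend₃-y : ∀ j → extend₃ N M a c c' d (N + toℕ j) ≡ c j
  extend₃-y j = ≡-trans (extend-+ N a _ (toℕ j)) (extend-toℕ M c _ j)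

  extend₃-z : ∀ j → extend₃ N M a c c' d (N + M + toℕ j) ≡ c' j
  extend₃-z j = begin
    extend₃ N M a c c' d (N + M + toℕ j)   ≡⟨ cong (extend₃ N M a c c' d) (+-assoc N M (toℕ j)) ⟩
    extend₃ N M a c c' d (N + (M + toℕ j)) ≡⟨ extend-+ N a _ (M + toℕ j) ⟩
    extend M c _ (M + toℕ j)               ≡⟨ extend-+ M c _ (toℕ j) ⟩
    extend M c' _ (toℕ j)                  ≡⟨ extend-toℕ M c' _ j ⟩
    c' j                                   ∎
    where open ≡-Reasoning

module _ {τ : Signature} (A : Algebra τ) where
  open Algebra A
  open IsEquivalence isEquiv renaming (refl to ≈-refl)

  ≡⇒≈ : ∀ {a b} → a ≡ b → a ≈ b
  ≡⇒≈ refl = ≈-refl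

  mutual
    eval-sub : ∀ {X Y} (ρ : Y → Carrier) (σ : X → Term τ Y) t →
               eval A ρ (sub σ t) ≈ eval A (eval A ρ ∘ σ) t
    eval-sub ρ σ (var x)   = ≈-refl
    eval-sub ρ σ (op f ts) = ⟦⟧-cong f (eval*-sub ρ σ ts)

    eval*-sub : ∀ {X Y n} (ρ : Y → Carrier) (σ : X → Term τ Y) (ts : Vec (Term τ X) n) →
                ∀ i → eval* A ρ (sub* σ ts) i ≈ eval* A (eval A ρ ∘ σ) ts i
    eval*-sub ρ σ (t ∷ ts) zero    = eval-sub ρ σ t
    eval*-sub ρ σ (t ∷ ts) (suc i) = eval*-sub ρ σ ts i

  eval*-tabulate : ∀ {X n} (ρ : X → Carrier) (g : Fin n → Term τ X) i →
                   eval* A ρ (tabulate g) i ≡ eval A ρ (g i)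
  eval*-tabulate ρ g zero    = refl
  eval*-tabulate ρ g (suc i) = eval*-tabulate ρ (g ∘ suc) i

⊨EFD⇒unique : ∀ {τ} (A : Algebra τ) (φ : EFD τ) → A ⊨EFD φ → ∀ a c c' →
              SatEFD A φ a c → SatEFD A φ a c' → ∀ j → Algebra._≈_ A (c j) (c' j)
⊨EFD⇒unique A φ A⊨φ a c c' sat sat' j =
  ≈-trans (≈-sym (proj₂ (proj₂ (A⊨φ a)) c sat j)) (proj₂ (proj₂ (A⊨φ a)) c' sat' j)
  where open IsEquivalence (Algebra.isEquiv A) renaming (sym to ≈-sym; trans to ≈-trans)

module _ {τ : Signature} {E : Expansion τ} (B : Algebra (sig E)) where
  open Algebra B
  open IsEquivalence isEquiv renaming (refl to ≈-refl)

  mutual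
    eval-emb : ∀ {X} (ρ : X → Carrier) t → eval B ρ (emb t) ≈ eval (reduct B) ρ t
    eval-emb ρ (var x)   = ≈-refl
    eval-emb ρ (op f ts) = ⟦⟧-cong (inj₁ f) (eval*-emb ρ ts)

    eval*-emb : ∀ {X n} (ρ : X → Carrier) (ts : Vec (Term τ X) n) →
                ∀ i → eval* B ρ (emb* ts) i ≈ eval* (reduct B) ρ ts i
    eval*-emb ρ (t ∷ ts) zero    = eval-emb ρ t
    eval*-emb ρ (t ∷ ts) (suc i) = eval*-emb ρ ts i

module _ {τ : Signature} {E₁ E₂ : Expansion τ} (A : Algebra (sig E₂)) (T : Translation E₁ E₂) where
  open Algebra A
  open IsEquivalence isEquiv renaming (refl to ≈-refl; trans to ≈-trans)

  mutual
    eval-trans : ∀ {X} (ρ : X → Carrier) t → eval A ρ (trans T t) ≈ eval (A ^ T) ρ t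
    eval-trans ρ (var x)          = ≈-refl
    eval-trans ρ (op (inj₁ f) ts) = ⟦⟧-cong (inj₁ f) (eval*-trans ρ ts)
    eval-trans ρ (op (inj₂ g) ts) =
      ≈-trans (eval-sub A ρ (lookup (trans* T ts)) (T g)) (eval-cong A (eval-lookup-trans ρ ts) (T g))

    eval*-trans : ∀ {X n} (ρ : X → Carrier) (ts : Vec (Term (sig E₁) X) n) →
                  ∀ i → eval* A ρ (trans* T ts) i ≈ eval* (A ^ T) ρ ts i
    eval*-trans ρ (t ∷ ts) zero    = eval-trans ρ t
    eval*-trans ρ (t ∷ ts) (suc i) = eval*-trans ρ ts i

    eval-lookup-trans : ∀ {X n} (ρ : X → Carrier) (ts : Vec (Term (sig E₁) X) n) →
                        ∀ i → eval A ρ (lookup (trans* T ts) i) ≈ eval* (A ^ T) ρ ts i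
    eval-lookup-trans ρ (t ∷ ts) zero    = eval-trans ρ t
    eval-lookup-trans ρ (t ∷ ts) (suc i) = eval-lookup-trans ρ ts i

module _ {τ : Signature} {E₁ E₂ : Expansion τ} (B : Algebra (sig E₁))
         (S : Translation E₂ E₁) (T : Translation E₁ E₂) (inverse : IsInverseOn S T B) where
  open Algebra B
  open IsEquivalence isEquiv renaming (refl to ≈-refl; trans to ≈-trans)

  mutual
    eval-inverse : ∀ {X} (ρ : X → Carrier) t → eval ((B ^ S) ^ T) ρ t ≈ eval B ρ t
    eval-inverse ρ (var x)   = ≈-refl
    eval-inverse ρ (op f ts) =
      ≈-trans (Algebra.⟦⟧-cong ((B ^ S) ^ T) f (eval*-inverse ρ ts)) (inverse f (eval* B ρ ts))

    eval*-inverse : ∀ {X n} (ρ : X → Carrier) (ts : Vec (Term (sig E₁) X) n) →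
                    ∀ i → eval* ((B ^ S) ^ T) ρ ts i ≈ eval* B ρ ts i
    eval*-inverse ρ (t ∷ ts) zero    = eval-inverse ρ t
    eval*-inverse ρ (t ∷ ts) (suc i) = eval*-inverse ρ ts i

module Algebraizable {τ : Signature} (L : Logic τ) (K : Class τ)
       (Δ : List (Term τ (Fin 2))) (E : Pred (Eqn τ (Fin 1)) 0ℓ)
       (alg : IsAlgebraizable L K Δ E) where

  open Logic L using (_⊢_)

  private
    x₀ y₀ : Term τ ℕ
    x₀ = var 0
    y₀ = var 1

  module _ (C : Algebra τ) where
    open Algebra C
    open IsEquivalence isEquiv renaming (refl to ≈-refl; sym to ≈-sym; trans to ≈-trans)

    Designated : Carrier → Set
    Designated w = ∀ e₀ → E e₀ → eval C (const w) (proj₁ e₀) ≈ eval C (const w) (proj₂ e₀)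

    designated-cong : ∀ {w w'} → w ≈ w' → Designated w → Designated w'
    designated-cong w≈w' d e₀ Ee₀ =
      ≈-trans (≈-sym (eval-cong C (const w≈w') (proj₁ e₀))) (≈-trans (d e₀ Ee₀) (eval-cong C (const w≈w') (proj₂ e₀)))

    E-instance⇒ : ∀ (ρ : ℕ → Carrier) ψ (e₀ : Eqn τ (Fin 1)) →
                  Holds C ρ (sub (const ψ) (proj₁ e₀) , sub (const ψ) (proj₂ e₀)) →
                  Holds C (const (eval C ρ ψ)) e₀
    E-instance⇒ ρ ψ e₀ h = ≈-trans (≈-sym (eval-sub C ρ (const ψ) (proj₁ e₀))) (≈-trans h (eval-sub C ρ (const ψ) (proj₂ e₀)))

    E-instance⇐ : ∀ (ρ : ℕ → Carrier) ψ (e₀ : Eqn τ (Fin 1)) →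
                  Holds C (const (eval C ρ ψ)) e₀ →
                  Holds C ρ (sub (const ψ) (proj₁ e₀) , sub (const ψ) (proj₂ e₀))
    E-instance⇐ ρ ψ e₀ h = ≈-trans (eval-sub C ρ (const ψ) (proj₁ e₀)) (≈-trans h (≈-sym (eval-sub C ρ (const ψ) (proj₂ e₀))))

    eval-pair : ∀ {X} (ρ : X → Carrier) a b δ →
                eval C ρ (sub (pair a b) δ) ≈ eval C (pair (eval C ρ a) (eval C ρ b)) δ
    eval-pair ρ a b δ = ≈-trans (eval-sub C ρ (pair a b) δ) (eval-cong C pointwise δ)
      where
      pointwise : ∀ i → eval C ρ (pair a b i) ≈ pair (eval C ρ a) (eval C ρ b) i
      pointwise zero       = ≈-refl
      pointwise (suc zero) = ≈-refl

  SoundRule : List (Fm τ) → Fm τ → Set₁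
  SoundRule ps c = ∀ C → K C → ∀ ρ → (∀ p → p ∈ ps → Designated C (eval C ρ p)) → Designated C (eval C ρ c)

  -- (A1) read through E: ⟪ps⟫ ⊢ c exactly when the rule is sound in K.
  ⊢-sound : ∀ {ps c} → ⟪ ps ⟫ ⊢ c → SoundRule ps c
  ⊢-sound {ps} {c} d C C∈K ρ premises e₀ Ee₀ =
    E-instance⇒ C ρ c e₀ (proj₁ (proj₁ alg ⟪ ps ⟫ c) d _ (e₀ , Ee₀ , refl) C C∈K ρ premises')
    where
    premises' : ∀ e' → E[ E , ⟪ ps ⟫ ] e' → Holds C ρ e'
    premises' _ (ψ , ψ∈ps , (e₁ , Ee₁ , refl)) = E-instance⇐ C ρ ψ e₁ (premises ψ ψ∈ps e₁ Ee₁)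

  ⊢-complete : ∀ ps c → SoundRule ps c → ⟪ ps ⟫ ⊢ c
  ⊢-complete ps c sound = proj₂ (proj₁ alg ⟪ ps ⟫ c) conclusion
    where
    conclusion : ∀ e → E⟨ E , c ⟩ e → E[ E , ⟪ ps ⟫ ] ⊨[ K ] e
    conclusion _ (e₀ , Ee₀ , refl) C C∈K ρ hyps = E-instance⇐ C ρ c e₀ (sound C C∈K ρ premises e₀ Ee₀)
      where
      premises : ∀ p → p ∈ ps → Designated C (eval C ρ p)
      premises p p∈ps e₁ Ee₁ = E-instance⇒ C ρ p e₁ (hyps _ (p , p∈ps , (e₁ , Ee₁ , refl)))

  -- (A4) read through E: in K, u ≈ v iff every δ(u,v), δ ∈ Δ, is designated.
  ≈⇒Δ-designated : ∀ C → K C → ∀ {u v} → Algebra._≈_ C u v →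
                   ∀ δ → δ ∈ Δ → Designated C (eval C (pair u v) δ)
  ≈⇒Δ-designated C C∈K {u} {v} u≈v δ δ∈Δ =
    designated-cong C (eval-pair C (assign₃ u v u) x₀ y₀ δ) designated
    where
    ψ = sub (pair x₀ y₀) δ
    premise : ∀ e' → ｛ (x₀ , y₀) ｝ e' → Holds C (assign₃ u v u) e'
    premise _ refl = u≈v
    designated : Designated C (eval C (assign₃ u v u) ψ)
    designated e₁ Ee₁ = E-instance⇒ C (assign₃ u v u) ψ e₁
      (proj₁ (proj₂ alg) _ (ψ , ∈-map⁺ (sub (pair x₀ y₀)) δ∈Δ , (e₁ , Ee₁ , refl)) C C∈K (assign₃ u v u) premise)

  Δ-designated⇒≈ : ∀ C → K C → ∀ {u v} → (∀ δ → δ ∈ Δ → Designated C (eval C (pair u v) δ)) →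
                   Algebra._≈_ C u v
  Δ-designated⇒≈ C C∈K {u} {v} designated = proj₂ (proj₂ alg) C C∈K (assign₃ u v u) premises
    where
    open Algebra C
    open IsEquivalence isEquiv renaming (sym to ≈-sym)
    premises : ∀ e' → E[ E , ⟪ Δ⟨ Δ , x₀ ⟩ y₀ ⟫ ] e' → Holds C (assign₃ u v u) e'
    premises _ (ψ , ψ∈ , (e₁ , Ee₁ , refl)) with ∈-map⁻ (sub (pair x₀ y₀)) ψ∈
    ... | δ , δ∈Δ , refl = E-instance⇐ C (assign₃ u v u) ψ e₁
            (designated-cong C (≈-sym (eval-pair C (assign₃ u v u) x₀ y₀ δ)) (designated δ δ∈Δ) e₁ Ee₁)

  Δ[_] : List (Eqn τ ℕ) → List (Fm τ)
  Δ[ H ] = concatMap (λ h → Δ⟨ Δ , proj₁ h ⟩ (proj₂ h)) H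

  ∈-Δ[]⁺ : ∀ {H h δ} → h ∈ H → δ ∈ Δ → sub (pair (proj₁ h) (proj₂ h)) δ ∈ Δ[ H ]
  ∈-Δ[]⁺ {h = h} h∈H δ∈Δ =
    ∈-concatMap⁺ (λ h → Δ⟨ Δ , proj₁ h ⟩ (proj₂ h)) (lose h∈H (∈-map⁺ (sub (pair (proj₁ h) (proj₂ h))) δ∈Δ))

  ∈-Δ[]⁻ : ∀ H {p} → p ∈ Δ[ H ] → ∃ λ h → h ∈ H × ∃ λ δ → δ ∈ Δ × p ≡ sub (pair (proj₁ h) (proj₂ h)) δ
  ∈-Δ[]⁻ H p∈ with find (∈-concatMap⁻ (λ h → Δ⟨ Δ , proj₁ h ⟩ (proj₂ h)) {H} p∈)
  ... | h , h∈H , p∈' with ∈-map⁻ (sub (pair (proj₁ h) (proj₂ h))) p∈'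
  ... | δ , δ∈Δ , p≡ = h , h∈H , δ , δ∈Δ , p≡

  ValidIn : List (Eqn τ ℕ) → Eqn τ ℕ → Set₁
  ValidIn H e = ∀ C → K C → ∀ ρ → (∀ h → h ∈ H → Holds C ρ h) → Holds C ρ e

  valid⇒Δ-rule : ∀ H e → ValidIn H e → ∀ δ → δ ∈ Δ → ⟪ Δ[ H ] ⟫ ⊢ sub (pair (proj₁ e) (proj₂ e)) δ
  valid⇒Δ-rule H e valid δ δ∈Δ = ⊢-complete Δ[ H ] _ sound
    where
    sound : SoundRule Δ[ H ] (sub (pair (proj₁ e) (proj₂ e)) δ)
    sound C C∈K ρ premises =
      designated-cong C (≈-sym (eval-pair C ρ (proj₁ e) (proj₂ e) δ)) (≈⇒Δ-designated C C∈K (valid C C∈K ρ hyps) δ δ∈Δ)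
      where
      open Algebra C
      open IsEquivalence isEquiv renaming (sym to ≈-sym)
      hyps : ∀ h → h ∈ H → Holds C ρ h
      hyps h h∈H = Δ-designated⇒≈ C C∈K λ δ' δ'∈Δ →
        designated-cong C (eval-pair C ρ (proj₁ h) (proj₂ h) δ') (premises _ (∈-Δ[]⁺ h∈H δ'∈Δ))

  Δ-detachment : ⟪ x₀ ∷ Δ⟨ Δ , x₀ ⟩ y₀ ⟫ ⊢ y₀
  Δ-detachment = ⊢-complete _ _ sound
    where
    sound : SoundRule (x₀ ∷ Δ⟨ Δ , x₀ ⟩ y₀) y₀
    sound C C∈K ρ premises = designated-cong C x≈y (premises _ (here refl))
      where
      x≈y : Algebra._≈_ C (ρ 0) (ρ 1)
      x≈y = Δ-designated⇒≈ C C∈K λ δ δ∈Δ →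
        designated-cong C (eval-pair C ρ x₀ y₀ δ) (premises _ (there (∈-map⁺ (sub (pair x₀ y₀)) δ∈Δ)))

-- The relation  s ~[Θ] t := Θ ⊢ Δ(s,t)  is a
-- congruence on formulas (all quasi-identities valid in K transfer to it),
-- and modulo ~ the terms f^φ(x̄) are the unique solutions of the EFD-systems.
module DerivationsΣ {τ : Signature} (L : Logic τ) (K : Class τ)
       (Δ : List (Term τ (Fin 2))) (E : Pred (Eqn τ (Fin 1)) 0ℓ)
       (alg : IsAlgebraizable L K Δ E) (Sg : Pred (EFD τ) 0ℓ) where

  open Algebraizable L K Δ E alg

  S : Signature
  S = sig (ExpΣ Sg)

  _⊩_ : Pred (Fm S) 0ℓ → Fm S → Set
  _⊩_ = _⊢Σ_ L Δ Sg

  Φ : (φ : EFD τ) → (Fin (n φ) ⊎ Fin (m φ) → Fm S) → List (Fm S)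
  Φ = Φ⟨_,_⟩ L Δ Sg

  by-rule : ∀ {Θ ps c} → RuleΣ L Δ Sg ps c → (σ : ℕ → Fm S) → (∀ q → q ∈ ps → Θ ⊩ sub σ q) → Θ ⊩ sub σ c
  by-rule r σ premises = rule r σ (All.tabulate (λ {q} → premises q))

  mutual
    ⊩-subst : ∀ {Θ Θ' φ} (σ : ℕ → Fm S) → (∀ θ → Θ θ → Θ' ⊩ sub σ θ) → Θ ⊩ φ → Θ' ⊩ sub σ φ
    ⊩-subst σ h (hyp p) = h _ p
    ⊩-subst {Θ' = Θ'} σ h (rule {c = c} r π premises) =
      subst (Θ' ⊩_) (≡-sym (sub-sub σ π c)) (rule r (sub σ ∘ π) (⊩-subst* σ π h premises))

    ⊩-subst* : ∀ {Θ Θ' ps} (σ π : ℕ → Fm S) → (∀ θ → Θ θ → Θ' ⊩ sub σ θ) →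
               All (λ q → Θ ⊩ sub π q) ps → All (λ q → Θ' ⊩ sub (sub σ ∘ π) q) ps
    ⊩-subst* σ π h [] = []
    ⊩-subst* {Θ' = Θ'} σ π h (_∷_ {x = q} d ds) =
      subst (Θ' ⊩_) (sub-sub σ π q) (⊩-subst σ h d) ∷ ⊩-subst* σ π h ds

  ⊩-weaken : ∀ {Θ Θ' φ} → (∀ ψ → Θ ψ → Θ' ψ) → Θ ⊩ φ → Θ' ⊩ φ
  ⊩-weaken {Θ' = Θ'} {φ} Θ⊆Θ' d =
    subst (Θ' ⊩_) (sub-var φ) (⊩-subst var (λ θ θ∈ → subst (Θ' ⊩_) (≡-sym (sub-var θ)) (hyp (Θ⊆Θ' θ θ∈))) d)

  L-rule : ∀ {Θ ps c} → Logic._⊢_ L ⟪ ps ⟫ c → (σ : ℕ → Fm S) →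
           (∀ p → p ∈ ps → Θ ⊩ sub σ (emb p)) → Θ ⊩ sub σ (emb c)
  L-rule {ps = ps} {c} d σ premises = by-rule (base ps c d) σ premises'
    where
    premises' : ∀ q → q ∈ map emb ps → _ ⊩ sub σ q
    premises' q q∈ with ∈-map⁻ emb q∈
    ... | p , p∈ps , refl = premises p p∈ps

  rule-derivable : ∀ {ps c} → RuleΣ L Δ Sg ps c → ⟪ ps ⟫ ⊩ c
  rule-derivable {ps} {c} r =
    subst (⟪ ps ⟫ ⊩_) (sub-var c) (by-rule r var (λ q q∈ → subst (⟪ ps ⟫ ⊩_) (≡-sym (sub-var q)) (hyp q∈)))

  _~[_]_ : Fm S → Pred (Fm S) 0ℓ → Fm S → Set
  s ~[ Θ ] t = ∀ δ → δ ∈ Δ → Θ ⊩ sub (pair s t) (emb δ)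

  ~-resp : ∀ {Θ s s' t t'} → s ≡ s' → t ≡ t' → s ~[ Θ ] t → s' ~[ Θ ] t'
  ~-resp refl refl s~t = s~t

  sub-emb-pair : ∀ (σ : ℕ → Fm S) (a b : Term τ ℕ) δ →
                 sub σ (emb (sub (pair a b) δ)) ≡ sub (pair (sub σ (emb a)) (sub σ (emb b))) (emb δ)
  sub-emb-pair σ a b δ = ≡-trans (cong (sub σ) (emb-sub-pair a b δ)) (sub-pair σ (emb a) (emb b) (emb δ))

  valid⇒~ : ∀ {Θ} H e → ValidIn H e → (σ : ℕ → Fm S) →
            (∀ h → h ∈ H → sub σ (emb (proj₁ h)) ~[ Θ ] sub σ (emb (proj₂ h))) →
            sub σ (emb (proj₁ e)) ~[ Θ ] sub σ (emb (proj₂ e))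
  valid⇒~ {Θ} H e valid σ hyps δ δ∈Δ =
    subst (Θ ⊩_) (sub-emb-pair σ (proj₁ e) (proj₂ e) δ) (L-rule (valid⇒Δ-rule H e valid δ δ∈Δ) σ premises)
    where
    premises : ∀ p → p ∈ Δ[ H ] → Θ ⊩ sub σ (emb p)
    premises p p∈ with ∈-Δ[]⁻ H p∈
    ... | h , h∈H , δ' , δ'∈Δ , refl =
      subst (Θ ⊩_) (≡-sym (sub-emb-pair σ (proj₁ h) (proj₂ h) δ')) (hyps h h∈H δ' δ'∈Δ)

  ~⇒derivable : ∀ {s t} → s ~[ (λ _ → ⊥) ] t → ｛ s ｝ ⊩ t
  ~⇒derivable {s} {t} s~t = L-rule Δ-detachment (assign₃ s t s) premises
    where
    premises : ∀ p → p ∈ var 0 ∷ Δ⟨ Δ , var 0 ⟩ (var 1) → ｛ s ｝ ⊩ sub (assign₃ s t s) (emb p)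
    premises _ (here refl) = hyp refl
    premises p (there p∈) with ∈-map⁻ (sub (pair (var 0) (var 1))) p∈
    ... | δ , δ∈Δ , refl = subst (｛ s ｝ ⊩_) (≡-sym (sub-emb-pair (assign₃ s t s) (var 0) (var 1) δ))
                                  (⊩-weaken (λ _ ()) (s~t δ δ∈Δ))

  module _ {Θ : Pred (Fm S) 0ℓ} where
    private
      x₀ x₁ x₂ : Term τ ℕ
      x₀ = var 0
      x₁ = var 1
      x₂ = var 2

    ~-refl : ∀ {s} → s ~[ Θ ] s
    ~-refl {s} = valid⇒~ [] (x₀ , x₀) (λ C _ _ _ → IsEquivalence.refl (Algebra.isEquiv C)) (const s) (λ _ ())

    ~-sym : ∀ {s t} → s ~[ Θ ] t → t ~[ Θ ] s
    ~-sym {s} {t} s~t = valid⇒~ ((x₀ , x₁) ∷ []) (x₁ , x₀) valid (assign₃ s t t) λ { _ (here refl) → s~t }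
      where
      valid : ValidIn ((x₀ , x₁) ∷ []) (x₁ , x₀)
      valid C _ _ hyps = IsEquivalence.sym (Algebra.isEquiv C) (hyps _ (here refl))

    ~-trans : ∀ {s t u} → s ~[ Θ ] t → t ~[ Θ ] u → s ~[ Θ ] u
    ~-trans {s} {t} {u} s~t t~u = valid⇒~ H (x₀ , x₂) valid (assign₃ s t u) hyps
      where
      H : List (Eqn τ ℕ)
      H = (x₀ , x₁) ∷ (x₁ , x₂) ∷ []
      hyps : ∀ h → h ∈ H → sub (assign₃ s t u) (emb (proj₁ h)) ~[ Θ ] sub (assign₃ s t u) (emb (proj₂ h))
      hyps _ (here refl)         = s~t
      hyps _ (there (here refl)) = t~u
      valid : ValidIn H (x₀ , x₂)
      valid C _ _ hyps' = IsEquivalence.trans (Algebra.isEquiv C) (hyps' _ (here refl)) (hyps' _ (there (here refl)))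

    -- ~ is compatible with the τ-operations: an instance of the valid
    -- quasi-identity  ⋀ᵢ xᵢ = x_{k+i} → f(x₀…x_{k-1}) = f(x_k…x_{2k-1}).
    op-cong : ∀ f (us vs : Vec (Fm S) (ar τ f)) → (∀ i → lookup us i ~[ Θ ] lookup vs i) →
              op (inj₁ f) us ~[ Θ ] op (inj₁ f) vs
    op-cong f us vs us~vs =
      ~-resp (cong (op (inj₁ f)) (sub*-emb-vars σ toℕ us (extend₃-x k k (lookup us) (lookup vs) (lookup vs) (var 0))))
             (cong (op (inj₁ f)) (sub*-emb-vars σ (λ i → k + toℕ i) vs (extend₃-y k k (lookup us) (lookup vs) (lookup vs) (var 0))))
             (valid⇒~ H e valid σ hyps)
      where
      k : ℕ
      k = ar τ f
      σ : ℕ → Fm S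
      σ = extend₃ k k (lookup us) (lookup vs) (lookup vs) (var 0)
      hyp-i : Fin k → Eqn τ ℕ
      hyp-i i = var (toℕ i) , var (k + toℕ i)
      H : List (Eqn τ ℕ)
      H = map hyp-i (allFin k)
      e : Eqn τ ℕ
      e = op f (tabulate (λ i → var (toℕ i))) , op f (tabulate (λ i → var (k + toℕ i)))
      valid : ValidIn H e
      valid C _ ρ hyps' = Algebra.⟦⟧-cong C f λ i →
        subst₂ (Algebra._≈_ C) (≡-sym (eval*-tabulate C ρ _ i)) (≡-sym (eval*-tabulate C ρ _ i))
               (hyps' (hyp-i i) (∈-map⁺ hyp-i (∈-allFin i)))
      hyps : ∀ h → h ∈ H → sub σ (emb (proj₁ h)) ~[ Θ ] sub σ (emb (proj₂ h))
      hyps h h∈H with ∈-map⁻ hyp-i h∈H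
      ... | i , _ , refl = ~-resp (≡-sym (extend₃-x k k (lookup us) (lookup vs) (lookup vs) (var 0) i))
                                  (≡-sym (extend₃-y k k (lookup us) (lookup vs) (lookup vs) (var 0) i)) (us~vs i)

    mutual
      sub-emb-cong : ∀ {Y : Set} (π π' : Y → Fm S) → (∀ y → π y ~[ Θ ] π' y) →
                     ∀ (t : Term τ Y) → sub π (emb t) ~[ Θ ] sub π' (emb t)
      sub-emb-cong π π' π~π' (var y)   = π~π' y
      sub-emb-cong π π' π~π' (op f ts) = op-cong f _ _ (sub*-emb-cong π π' π~π' ts)

      sub*-emb-cong : ∀ {Y : Set} {k} (π π' : Y → Fm S) → (∀ y → π y ~[ Θ ] π' y) →
                      ∀ (ts : Vec (Term τ Y) k) i → lookup (sub* π (emb* ts)) i ~[ Θ ] lookup (sub* π' (emb* ts)) i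
      sub*-emb-cong π π' π~π' (t ∷ ts) zero    = sub-emb-cong π π' π~π' t
      sub*-emb-cong π π' π~π' (t ∷ ts) (suc i) = sub*-emb-cong π π' π~π' ts i

    Solves : (φ : EFD τ) → (Fin (n φ) ⊎ Fin (m φ) → Fm S) → Set
    Solves φ π = ∀ e → e ∈ eqs φ → sub π (emb (proj₁ e)) ~[ Θ ] sub π (emb (proj₂ e))

  Solves-resp : ∀ {Θ} φ {π π'} → (∀ y → π y ≡ π' y) → Solves {Θ} φ π → Solves {Θ} φ π'
  Solves-resp φ π≡π' sol e e∈ = ~-resp (sub-cong π≡π' (emb (proj₁ e))) (sub-cong π≡π' (emb (proj₂ e))) (sol e e∈)

  Φ-instance : ∀ {Y : Set} (π : Y → Fm S) (e : Eqn τ Y) (δ : Term τ (Fin 2)) → Fm S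
  Φ-instance π e δ = sub (pair (sub π (emb (proj₁ e))) (sub π (emb (proj₂ e)))) (emb δ)

  Φ-∈⁻ : ∀ φ π {χ} → χ ∈ Φ φ π → ∃ λ e → e ∈ eqs φ × ∃ λ δ → δ ∈ Δ × χ ≡ Φ-instance π e δ
  Φ-∈⁻ φ π χ∈ with find (∈-concatMap⁻ (λ e → ΔΣ⟨_,_⟩ L Δ Sg (sub π (emb (proj₁ e))) (sub π (emb (proj₂ e)))) {eqs φ} χ∈)
  ... | e , e∈ , χ∈' with ∈-map⁻ (sub (pair (sub π (emb (proj₁ e))) (sub π (emb (proj₂ e)))) ∘ emb) χ∈'
  ... | δ , δ∈Δ , χ≡ = e , e∈ , δ , δ∈Δ , χ≡


  Φ-∈⁺ : ∀ φ π {e δ} → e ∈ eqs φ → δ ∈ Δ → Φ-instance π e δ ∈ Φ φ π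
  Φ-∈⁺ φ π {e} e∈ δ∈Δ =
    ∈-concatMap⁺ (λ e → ΔΣ⟨_,_⟩ L Δ Sg (sub π (emb (proj₁ e))) (sub π (emb (proj₂ e))))
                 (lose e∈ (∈-map⁺ (sub (pair (sub π (emb (proj₁ e))) (sub π (emb (proj₂ e)))) ∘ emb) δ∈Δ))

  sub-Φ-instance : ∀ (σ : ℕ → Fm S) {Y : Set} (π₀ π : Y → Fm S) → (∀ y → sub σ (π₀ y) ≡ π y) →
                   ∀ e δ → sub σ (Φ-instance π₀ e δ) ≡ Φ-instance π e δ
  sub-Φ-instance σ π₀ π σπ₀≡π e δ =
    ≡-trans (sub-pair σ _ _ (emb δ)) (cong₂ (λ u v → sub (pair u v) (emb δ)) (side (proj₁ e)) (side (proj₂ e)))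
    where
    side : ∀ t → sub σ (sub π₀ (emb t)) ≡ sub π (emb t)
    side t = ≡-trans (sub-sub σ π₀ (emb t)) (sub-cong σπ₀≡π (emb t))

  module _ (φ : EFD τ) {A : Set} (a : Fin (n φ) → A) (c c' : Fin (m φ) → A) (d : A)
           (h : Fm S → A) (h-var : ∀ k → h (var k) ≡ extend₃ (n φ) (m φ) a c c' d k) where
    at-ρy : ∀ x → h (ρy L Δ Sg φ x) ≡ [ a , c ] x
    at-ρy (inj₁ i) = ≡-trans (h-var _) (extend₃-x (n φ) (m φ) a c c' d i)
    at-ρy (inj₂ j) = ≡-trans (h-var _) (extend₃-y (n φ) (m φ) a c c' d j)

    at-ρz : ∀ x → h (ρz L Δ Sg φ x) ≡ [ a , c' ] x
    at-ρz (inj₁ i) = ≡-trans (h-var _) (extend₃-x (n φ) (m φ) a c c' d i)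
    at-ρz (inj₂ j) = ≡-trans (h-var _) (extend₃-z (n φ) (m φ) a c c' d j)

  new-terms : ∀ {Y : Set} φ → Sg φ → (Fin (n φ) → Term S Y) → Fin (m φ) → Term S Y
  new-terms φ p us j = op (inj₂ (φ , p , j)) (tabulate us)

  module _ {Θ : Pred (Fm S) 0ℓ} where
    Solves⇒Φ : ∀ φ (σ : ℕ → Fm S) π₀ π → (∀ y → sub σ (π₀ y) ≡ π y) →
               Solves {Θ} φ π → ∀ χ → χ ∈ Φ φ π₀ → Θ ⊩ sub σ χ
    Solves⇒Φ φ σ π₀ π σπ₀≡π sol χ χ∈ with Φ-∈⁻ φ π₀ χ∈
    ... | e , e∈ , δ , δ∈Δ , refl = subst (Θ ⊩_) (≡-sym (sub-Φ-instance σ π₀ π σπ₀≡π e δ)) (sol e e∈ δ δ∈Δ)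

    Φ⇒Solves : ∀ φ (σ : ℕ → Fm S) π₀ π → (∀ y → sub σ (π₀ y) ≡ π y) →
               (∀ χ → χ ∈ Φ φ π₀ → Θ ⊩ sub σ χ) → Solves {Θ} φ π
    Φ⇒Solves φ σ π₀ π σπ₀≡π derivable e e∈ δ δ∈Δ =
      subst (Θ ⊩_) (sub-Φ-instance σ π₀ π σπ₀≡π e δ) (derivable _ (Φ-∈⁺ φ π₀ e∈ δ∈Δ))

    new-terms-solve : ∀ φ (p : Sg φ) (us : Fin (n φ) → Fm S) → Solves {Θ} φ [ us , new-terms φ p us ]
    new-terms-solve φ p us =
      Φ⇒Solves φ σ (ρf L Δ Sg φ p) _ at-ρf (λ χ χ∈ → by-rule (exist φ p χ∈) σ (λ _ ()))
      where
      σ : ℕ → Fm S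
      σ = extend (n φ) us (const (var 0))
      at-ρf : ∀ x → sub σ (ρf L Δ Sg φ p x) ≡ [ us , new-terms φ p us ] x
      at-ρf (inj₁ i) = extend-toℕ (n φ) us _ i
      at-ρf (inj₂ j) = cong (op (inj₂ (φ , p , j))) (sub*-extend-vars us _)

    solutions-unique : ∀ φ → Sg φ → (us : Fin (n φ) → Fm S) (cs cs' : Fin (m φ) → Fm S) →
                       Solves {Θ} φ [ us , cs ] → Solves {Θ} φ [ us , cs' ] → ∀ j → cs j ~[ Θ ] cs' j
    solutions-unique φ p us cs cs' sol sol' j δ δ∈Δ =
      subst (Θ ⊩_) conclusion
        (by-rule (unique φ p j (∈-map⁺ (sub (pair (yv L Δ Sg φ j) (zv L Δ Sg φ j)) ∘ emb) δ∈Δ)) σ premises)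
      where
      σ : ℕ → Fm S
      σ = extend₃ (n φ) (m φ) us cs cs' (var 0)
      conclusion : sub σ (sub (pair (yv L Δ Sg φ j) (zv L Δ Sg φ j)) (emb δ)) ≡ sub (pair (cs j) (cs' j)) (emb δ)
      conclusion = ≡-trans (sub-pair σ _ _ (emb δ))
        (cong₂ (λ u v → sub (pair u v) (emb δ)) (extend₃-y (n φ) (m φ) us cs cs' _ j) (extend₃-z (n φ) (m φ) us cs cs' _ j))
      premises : ∀ q → q ∈ Φ φ (ρy L Δ Sg φ) ++ Φ φ (ρz L Δ Sg φ) → Θ ⊩ sub σ q
      premises q q∈ with ∈-++⁻ (Φ φ (ρy L Δ Sg φ)) q∈
      ... | inj₁ q∈y = Solves⇒Φ φ σ _ _ (at-ρy φ us cs cs' _ (sub σ) (λ _ → refl)) sol q q∈y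
      ... | inj₂ q∈z = Solves⇒Φ φ σ _ _ (at-ρz φ us cs cs' _ (sub σ) (λ _ → refl)) sol' q q∈z

    -- ~ is compatible with the new operations: if ū ~ v̄ then f^φ(ū)
    -- solves α_φ(v̄, ·), so it agrees with f^φ(v̄) by uniqueness.
    new-op-cong : ∀ φ (p : Sg φ) j (us vs : Vec (Fm S) (n φ)) → (∀ i → lookup us i ~[ Θ ] lookup vs i) →
                  op (inj₂ (φ , p , j)) us ~[ Θ ] op (inj₂ (φ , p , j)) vs
    new-op-cong φ p j us vs us~vs =
      ~-resp (cong (op (inj₂ (φ , p , j))) (tabulate∘lookup us)) (cong (op (inj₂ (φ , p , j))) (tabulate∘lookup vs))
        (solutions-unique φ p (lookup vs) fu (new-terms φ p (lookup vs)) fu-solves (new-terms-solve φ p (lookup vs)) j)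
      where
      fu : Fin (m φ) → Fm S
      fu = new-terms φ p (lookup us)
      vs~us : ∀ x → [ lookup vs , fu ] x ~[ Θ ] [ lookup us , fu ] x
      vs~us (inj₁ i) = ~-sym (us~vs i)
      vs~us (inj₂ _) = ~-refl
      us~vs' : ∀ x → [ lookup us , fu ] x ~[ Θ ] [ lookup vs , fu ] x
      us~vs' (inj₁ i) = us~vs i
      us~vs' (inj₂ _) = ~-refl
      fu-solves : Solves {Θ} φ [ lookup vs , fu ]
      fu-solves e e∈ = ~-trans (sub-emb-cong _ _ vs~us (proj₁ e))
                        (~-trans (new-terms-solve φ p (lookup us) e e∈) (sub-emb-cong _ _ us~vs' (proj₂ e)))

-- The Lindenbaum algebra of L^Σ over generators X: Σ-terms over X, two of
-- them equal when their ι-images are ~[Θ]-related.  It lies in 𝒬^Σ.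
module Lindenbaum {τ : Signature} (L : Logic τ) (Γ : Pred (QuasiId τ) 0ℓ)
       (Δ : List (Term τ (Fin 2))) (E : Pred (Eqn τ (Fin 1)) 0ℓ)
       (alg : IsAlgebraizable L (ModQ Γ) Δ E) (Sg : Pred (EFD τ) 0ℓ)
       (X : Set) (ι : X → Fm (sig (ExpΣ Sg))) (Θ : Pred (Fm (sig (ExpΣ Sg))) 0ℓ) where

  open Algebraizable L (ModQ Γ) Δ E alg
  open DerivationsΣ L (ModQ Γ) Δ E alg Sg

  private
    lookup-ι : ∀ {k} (as : Fin k → Term S X) i → lookup (sub* ι (tabulate as)) i ≡ sub ι (as i)
    lookup-ι as i = ≡-trans (lookup-sub* ι (tabulate as) i) (cong (sub ι) (lookup∘tabulate as i))

    ops-cong : (f : Sym S) → {as bs : Fin (ar S f) → Term S X} → (∀ i → sub ι (as i) ~[ Θ ] sub ι (bs i)) →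
               sub ι (op f (tabulate as)) ~[ Θ ] sub ι (op f (tabulate bs))
    ops-cong (inj₁ f) {as} {bs} as~bs =
      op-cong f _ _ (λ i → ~-resp (≡-sym (lookup-ι as i)) (≡-sym (lookup-ι bs i)) (as~bs i))
    ops-cong (inj₂ (φ , p , j)) {as} {bs} as~bs =
      new-op-cong φ p j _ _ (λ i → ~-resp (≡-sym (lookup-ι as i)) (≡-sym (lookup-ι bs i)) (as~bs i))

  𝐋 : Algebra S
  𝐋 = record
    { Carrier = Term S X
    ; _≈_     = λ s t → sub ι s ~[ Θ ] sub ι t
    ; isEquiv = record { refl = ~-refl ; sym = ~-sym ; trans = ~-trans }
    ; ⟦_⟧     = λ f as → op f (tabulate as)
    ; ⟦⟧-cong = ops-cong }

  mutual
    eval-𝐋 : ∀ {Y : Set} (ρ : Y → Term S X) t → eval 𝐋 ρ t ≡ sub ρ t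
    eval-𝐋 ρ (var x)   = refl
    eval-𝐋 ρ (op f ts) = cong (op f) (eval*-𝐋 ρ ts)

    eval*-𝐋 : ∀ {Y : Set} {k} (ρ : Y → Term S X) (ts : Vec (Term S Y) k) → tabulate (eval* 𝐋 ρ ts) ≡ sub* ρ ts
    eval*-𝐋 ρ []       = refl
    eval*-𝐋 ρ (t ∷ ts) = cong₂ _∷_ (eval-𝐋 ρ t) (eval*-𝐋 ρ ts)

  mutual
    eval-reduct-𝐋 : ∀ {Y : Set} (ρ : Y → Term S X) t → eval (reduct 𝐋) ρ t ≡ sub ρ (emb t)
    eval-reduct-𝐋 ρ (var x)   = refl
    eval-reduct-𝐋 ρ (op f ts) = cong (op (inj₁ f)) (eval*-reduct-𝐋 ρ ts)

    eval*-reduct-𝐋 : ∀ {Y : Set} {k} (ρ : Y → Term S X) (ts : Vec (Term τ Y) k) →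
                     tabulate (eval* (reduct 𝐋) ρ ts) ≡ sub* ρ (emb* ts)
    eval*-reduct-𝐋 ρ []       = refl
    eval*-reduct-𝐋 ρ (t ∷ ts) = cong₂ _∷_ (eval-reduct-𝐋 ρ t) (eval*-reduct-𝐋 ρ ts)

  ι-eval-reduct : ∀ {Y : Set} (ρ : Y → Term S X) (π : Y → Fm S) → (∀ y → sub ι (ρ y) ≡ π y) →
                  ∀ t → sub ι (eval (reduct 𝐋) ρ t) ≡ sub π (emb t)
  ι-eval-reduct ρ π ιρ≡π t =
    ≡-trans (cong (sub ι) (eval-reduct-𝐋 ρ t)) (≡-trans (sub-sub ι ρ (emb t)) (sub-cong ιρ≡π (emb t)))

  Holds⇒~ : ∀ {Y : Set} (ρ : Y → Term S X) (e : Eqn τ Y) → Holds (reduct 𝐋) ρ e →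
            sub (sub ι ∘ ρ) (emb (proj₁ e)) ~[ Θ ] sub (sub ι ∘ ρ) (emb (proj₂ e))
  Holds⇒~ ρ e = ~-resp (ι-eval-reduct ρ _ (λ _ → refl) (proj₁ e)) (ι-eval-reduct ρ _ (λ _ → refl) (proj₂ e))

  ~⇒Holds : ∀ {Y : Set} (ρ : Y → Term S X) (e : Eqn τ Y) →
            sub (sub ι ∘ ρ) (emb (proj₁ e)) ~[ Θ ] sub (sub ι ∘ ρ) (emb (proj₂ e)) → Holds (reduct 𝐋) ρ e
  ~⇒Holds ρ e = ~-resp (≡-sym (ι-eval-reduct ρ _ (λ _ → refl) (proj₁ e))) (≡-sym (ι-eval-reduct ρ _ (λ _ → refl) (proj₂ e)))

  Sat⇒Solves : ∀ φ a c → SatEFD (reduct 𝐋) φ a c → Solves {Θ} φ [ sub ι ∘ a , sub ι ∘ c ]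
  Sat⇒Solves φ a c sat = Solves-resp φ ι∘ac (λ e e∈ → Holds⇒~ [ a , c ] e (All.lookup sat e∈))
    where
    ι∘ac : ∀ y → sub ι ([ a , c ] y) ≡ [ sub ι ∘ a , sub ι ∘ c ] y
    ι∘ac (inj₁ _) = refl
    ι∘ac (inj₂ _) = refl

  Solves⇒Sat : ∀ φ a c → Solves {Θ} φ [ sub ι ∘ a , sub ι ∘ c ] → SatEFD (reduct 𝐋) φ a c
  Solves⇒Sat φ a c sol = All.tabulate λ {e} e∈ → ~⇒Holds [ a , c ] e (Solves-resp φ ι∘ac sol e e∈)
    where
    ι∘ac : ∀ y → [ sub ι ∘ a , sub ι ∘ c ] y ≡ sub ι ([ a , c ] y)
    ι∘ac (inj₁ _) = refl
    ι∘ac (inj₂ _) = refl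

  𝐋∈𝒬 : ModQ Γ (reduct 𝐋)
  𝐋∈𝒬 q q∈Γ ρ hyps = ~⇒Holds ρ (QuasiId.concl q)
    (valid⇒~ (QuasiId.hyps q) (QuasiId.concl q) valid (sub ι ∘ ρ) (λ h h∈ → Holds⇒~ ρ h (All.lookup hyps h∈)))
    where
    valid : ValidIn (QuasiId.hyps q) (QuasiId.concl q)
    valid C C∈𝒬 ρ' hyps' = C∈𝒬 q q∈Γ ρ' (All.tabulate (λ {h} → hyps' h))

  𝐋⊨E : ∀ φ (p : Sg φ) a → SatEFD (reduct 𝐋) φ a (λ j → op (inj₂ (φ , p , j)) (tabulate a))
  𝐋⊨E φ p a = Solves⇒Sat φ a (new-terms φ p a) (Solves-resp φ ι∘f (new-terms-solve φ p (sub ι ∘ a)))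
    where
    ι∘f : ∀ y → [ sub ι ∘ a , new-terms φ p (sub ι ∘ a) ] y ≡ [ sub ι ∘ a , sub ι ∘ new-terms φ p a ] y
    ι∘f (inj₁ _) = refl
    ι∘f (inj₂ j) = cong (op (inj₂ (φ , p , j))) (≡-sym (sub*-tabulate ι a))

  𝐋⊨U : ∀ φ → Sg φ → ∀ a c c' → SatEFD (reduct 𝐋) φ a c → SatEFD (reduct 𝐋) φ a c' →
        ∀ j → sub ι (c j) ~[ Θ ] sub ι (c' j)
  𝐋⊨U φ p a c c' sat sat' =
    solutions-unique φ p (sub ι ∘ a) (sub ι ∘ c) (sub ι ∘ c') (Sat⇒Solves φ a c sat) (Sat⇒Solves φ a c' sat')

  𝐋∈𝒬Σ : QΣ Γ Sg 𝐋
  𝐋∈𝒬Σ = 𝐋∈𝒬 , 𝐋⊨E , 𝐋⊨U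

module SoundnessΣ {τ : Signature} (L : Logic τ) (Γ : Pred (QuasiId τ) 0ℓ)
       (Δ : List (Term τ (Fin 2))) (E : Pred (Eqn τ (Fin 1)) 0ℓ)
       (alg : IsAlgebraizable L (ModQ Γ) Δ E) (Sg : Pred (EFD τ) 0ℓ) where

  open Algebraizable L (ModQ Γ) Δ E alg
  open DerivationsΣ L (ModQ Γ) Δ E alg Sg

  True : (B : Algebra S) → (ℕ → Algebra.Carrier B) → Fm S → Set
  True B ρ ψ = Designated (reduct B) (eval B ρ ψ)

  module _ (B : Algebra S) where
    open Algebra B
    open IsEquivalence isEquiv renaming (refl to ≈-refl; trans to ≈-trans)

    eval-Δ : ∀ (ρ : ℕ → Carrier) s t δ →
             eval B ρ (sub (pair s t) (emb δ)) ≈ eval (reduct B) (pair (eval B ρ s) (eval B ρ t)) δ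
    eval-Δ ρ s t δ = ≈-trans (eval-sub B ρ (pair s t) (emb δ)) (≈-trans (eval-emb B _ δ) (eval-cong (reduct B) pointwise δ))
      where
      pointwise : ∀ i → eval B ρ (pair s t i) ≈ pair (eval B ρ s) (eval B ρ t) i
      pointwise zero       = ≈-refl
      pointwise (suc zero) = ≈-refl

  module _ (B : Algebra S) (B∈𝒬 : ModQ Γ (reduct B)) where
    open Algebra B
    open IsEquivalence isEquiv renaming (sym to ≈-sym; trans to ≈-trans)

    module _ (φ : EFD τ) (ρ : ℕ → Carrier) (π₀ : Fin (n φ) ⊎ Fin (m φ) → Fm S)
             (a : Fin (n φ) → Carrier) (c : Fin (m φ) → Carrier)
             (ρπ₀≈ac : ∀ x → eval B ρ (π₀ x) ≈ [ a , c ] x) where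

      private
        eval-instance : ∀ t → eval B ρ (sub π₀ (emb t)) ≈ eval (reduct B) [ a , c ] t
        eval-instance t = ≈-trans (eval-sub B ρ π₀ (emb t)) (≈-trans (eval-cong B ρπ₀≈ac (emb t)) (eval-emb B _ t))

      Φ-true⇒Sat : (∀ χ → χ ∈ Φ φ π₀ → True B ρ χ) → SatEFD (reduct B) φ a c
      Φ-true⇒Sat true = All.tabulate λ {e} e∈ →
        ≈-trans (≈-sym (eval-instance (proj₁ e)))
          (≈-trans (Δ-designated⇒≈ (reduct B) B∈𝒬 λ δ δ∈Δ →
                      designated-cong (reduct B) (eval-Δ B ρ _ _ δ) (true _ (Φ-∈⁺ φ π₀ e∈ δ∈Δ)))
                   (eval-instance (proj₂ e)))

      Sat⇒Φ-true : SatEFD (reduct B) φ a c → ∀ χ → χ ∈ Φ φ π₀ → True B ρ χ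
      Sat⇒Φ-true sat χ χ∈ with Φ-∈⁻ φ π₀ χ∈
      ... | e , e∈ , δ , δ∈Δ , refl = designated-cong (reduct B) (≈-sym (eval-Δ B ρ _ _ δ))
              (≈⇒Δ-designated (reduct B) B∈𝒬
                 (≈-trans (eval-instance (proj₁ e)) (≈-trans (All.lookup sat e∈) (≈-sym (eval-instance (proj₂ e))))) δ δ∈Δ)

  module _ (B : Algebra S) (B∈𝒬Σ : QΣ Γ Sg B) where
    open Algebra B
    open IsEquivalence isEquiv renaming (refl to ≈-refl; sym to ≈-sym)

    private
      B∈𝒬 : ModQ Γ (reduct B)
      B∈𝒬 = proj₁ B∈𝒬Σ
      B⊨E : ∀ φ (p : Sg φ) a → SatEFD (reduct B) φ a (λ j → ⟦ inj₂ (φ , p , j) ⟧ a)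
      B⊨E = proj₁ (proj₂ B∈𝒬Σ)
      B⊨U : ∀ φ → Sg φ → ∀ a c c' → SatEFD (reduct B) φ a c → SatEFD (reduct B) φ a c' → ∀ j → c j ≈ c' j
      B⊨U = proj₂ (proj₂ B∈𝒬Σ)

    -- each rule of L^Σ preserves truth: L-rules by (A1), E_Σ and U_Σ by
    -- the corresponding axioms of 𝒬^Σ
    rule-sound : ∀ {ps c} → RuleΣ L Δ Sg ps c → ∀ ρ → (∀ q → q ∈ ps → True B ρ q) → True B ρ c
    rule-sound (base ps₀ c₀ d) ρ premises =
      designated-cong (reduct B) (≈-sym (eval-emb B ρ c₀))
        (⊢-sound d (reduct B) B∈𝒬 ρ λ p p∈ →
           designated-cong (reduct B) (eval-emb B ρ p) (premises (emb p) (∈-map⁺ emb p∈)))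
    rule-sound (exist φ p χ∈) ρ _ =
      Sat⇒Φ-true B B∈𝒬 φ ρ (ρf L Δ Sg φ p) a fa ρρf≈ (B⊨E φ p a) _ χ∈
      where
      a = ρ ∘ toℕ
      fa = λ j → ⟦ inj₂ (φ , p , j) ⟧ a
      ρρf≈ : ∀ x → eval B ρ (ρf L Δ Sg φ p x) ≈ [ a , fa ] x
      ρρf≈ (inj₁ i) = ≈-refl
      ρρf≈ (inj₂ j) = ⟦⟧-cong (inj₂ (φ , p , j)) (λ i → ≡⇒≈ B (eval*-tabulate B ρ _ i))
    rule-sound (unique φ p j {χ} χ∈) ρ premises with ∈-map⁻ (sub (pair (yv L Δ Sg φ j) (zv L Δ Sg φ j)) ∘ emb) χ∈
    ... | δ , δ∈Δ , refl = designated-cong (reduct B) (≈-sym (eval-Δ B ρ _ _ δ))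
                             (≈⇒Δ-designated (reduct B) B∈𝒬 (B⊨U φ p a c c' sat-y sat-z j) δ δ∈Δ)
      where
      a : Fin (n φ) → Carrier
      a = ρ ∘ toℕ
      c c' : Fin (m φ) → Carrier
      c k = ρ (n φ + toℕ k)
      c' k = ρ (n φ + m φ + toℕ k)
      ρρy≈ : ∀ x → eval B ρ (ρy L Δ Sg φ x) ≈ [ a , c ] x
      ρρy≈ (inj₁ _) = ≈-refl
      ρρy≈ (inj₂ _) = ≈-refl
      ρρz≈ : ∀ x → eval B ρ (ρz L Δ Sg φ x) ≈ [ a , c' ] x
      ρρz≈ (inj₁ _) = ≈-refl
      ρρz≈ (inj₂ _) = ≈-refl
      sat-y : SatEFD (reduct B) φ a c
      sat-y = Φ-true⇒Sat B B∈𝒬 φ ρ _ a c ρρy≈ (λ q q∈ → premises q (∈-++⁺ˡ q∈))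
      sat-z : SatEFD (reduct B) φ a c'
      sat-z = Φ-true⇒Sat B B∈𝒬 φ ρ _ a c' ρρz≈ (λ q q∈ → premises q (∈-++⁺ʳ (Φ φ (ρy L Δ Sg φ)) q∈))

    mutual
      ⊩-sound : ∀ {Θ ψ} → Θ ⊩ ψ → ∀ ρ → (∀ θ → Θ θ → True B ρ θ) → True B ρ ψ
      ⊩-sound (hyp ψ∈Θ) ρ Θ-true = Θ-true _ ψ∈Θ
      ⊩-sound (rule {c = c} r σ premises) ρ Θ-true =
        designated-cong (reduct B) (≈-sym (eval-sub B ρ σ c))
          (rule-sound r (eval B ρ ∘ σ) λ q q∈ →
             designated-cong (reduct B) (eval-sub B ρ σ q) (⊩-sound* premises ρ Θ-true q∈))

      ⊩-sound* : ∀ {Θ ps σ} → All (λ q → Θ ⊩ sub σ q) ps → ∀ ρ → (∀ θ → Θ θ → True B ρ θ) →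
                 ∀ {q} → q ∈ ps → True B ρ (sub σ q)
      ⊩-sound* (d ∷ ds) ρ Θ-true (here refl) = ⊩-sound d ρ Θ-true
      ⊩-sound* (d ∷ ds) ρ Θ-true (there q∈)  = ⊩-sound* ds ρ Θ-true q∈

module Correspondence {τ : Signature} (L : Logic τ) (Γ : Pred (QuasiId τ) 0ℓ)
       (Δ : List (Term τ (Fin 2))) (E : Pred (Eqn τ (Fin 1)) 0ℓ)
       (alg : IsAlgebraizable L (ModQ Γ) Δ E) where

  open Algebraizable L (ModQ Γ) Δ E alg

  QΣ⇒QMod : ∀ Sg B → QΣ Γ Sg B → QMod Γ Sg (reduct B)
  QΣ⇒QMod Sg B (B∈𝒬 , B⊨E , B⊨U) = B∈𝒬 , λ φ p a →
    (λ j → Algebra.⟦_⟧ B (inj₂ (φ , p , j)) a) , B⊨E φ p a , λ c' sat' j → B⊨U φ p a _ c' (B⊨E φ p a) sat' j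

  -- an algebra of 𝒬 ∩ Mod(Σ) expands to 𝒬^Σ, interpreting f^φ by the
  -- unique solutions of α_φ
  module Expand (Sg : Pred (EFD τ) 0ℓ) (A : Algebra τ) (A⊨Σ : ModΣ Sg A) where
    open Algebra A
    open IsEquivalence isEquiv renaming (refl to ≈-refl; sym to ≈-sym; trans to ≈-trans)

    solution : ∀ φ → Sg φ → (Fin (n φ) → Carrier) → Fin (m φ) → Carrier
    solution φ p a = proj₁ (A⊨Σ φ p a)

    solution-sat : ∀ φ (p : Sg φ) a → SatEFD A φ a (solution φ p a)
    solution-sat φ p a = proj₁ (proj₂ (A⊨Σ φ p a))

    solution-unique : ∀ φ (p : Sg φ) a c → SatEFD A φ a c → ∀ j → solution φ p a j ≈ c j
    solution-unique φ p a = proj₂ (proj₂ (A⊨Σ φ p a))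

    private
      ops : (f : Sym (sig (ExpΣ Sg))) → (Fin (ar (sig (ExpΣ Sg)) f) → Carrier) → Carrier
      ops (inj₁ f)           as = ⟦ f ⟧ as
      ops (inj₂ (φ , p , j)) as = solution φ p as j

      ops-cong : ∀ f {as bs} → (∀ i → as i ≈ bs i) → ops f as ≈ ops f bs
      ops-cong (inj₁ f) as≈bs = ⟦⟧-cong f as≈bs
      ops-cong (inj₂ (φ , p , j)) {as} {bs} as≈bs = solution-unique φ p as (solution φ p bs) sat j
        where
        params : ∀ y → [ as , solution φ p bs ] y ≈ [ bs , solution φ p bs ] y
        params (inj₁ i) = as≈bs i
        params (inj₂ _) = ≈-refl
        sat : SatEFD A φ as (solution φ p bs)
        sat = All.map (λ {e} h → ≈-trans (eval-cong A params (proj₁ e)) (≈-trans h (≈-sym (eval-cong A params (proj₂ e)))))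
                      (solution-sat φ p bs)

    expand : Algebra (sig (ExpΣ Sg))
    expand = record { Carrier = Carrier ; _≈_ = _≈_ ; isEquiv = isEquiv ; ⟦_⟧ = ops ; ⟦⟧-cong = ops-cong }

    expand∈QΣ : ModQ Γ A → QΣ Γ Sg expand
    expand∈QΣ A∈𝒬 = A∈𝒬 , solution-sat , λ φ p → ⊨EFD⇒unique A φ (A⊨Σ φ p)

  -- (ii) ⇒ (iii): expand, interpret, take the reduct
  interpretation⇒inclusion : ∀ Sg Sg' (T : Translation (ExpΣ Sg') (ExpΣ Sg)) →
                             IsInterpretation T (QΣ Γ Sg') (QΣ Γ Sg) → QMod Γ Sg ⊆K QMod Γ Sg'
  interpretation⇒inclusion Sg Sg' T T-interprets A (A∈𝒬 , A⊨Σ) =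
    QΣ⇒QMod Sg' (expand ^ T) (T-interprets expand (expand∈QΣ A∈𝒬))
    where open Expand Sg A A⊨Σ

  -- (i) ⇒ (ii): by soundness of L^Σ, A^T validates the translated rules of
  -- L^Σ', in particular those expressing E_Σ' and U_Σ'.
  module MorphismInterprets (Sg Sg' : Pred (EFD τ) 0ℓ) (T : Translation (ExpΣ Sg') (ExpΣ Sg))
         (T-morphism : IsMorphism T (_⊢Σ_ L Δ Sg') (_⊢Σ_ L Δ Sg))
         (A : Algebra (sig (ExpΣ Sg))) (A∈𝒬Σ : QΣ Γ Sg A) where

    open Algebra A
    open IsEquivalence isEquiv using () renaming (sym to ≈-sym)
    open DerivationsΣ L (ModQ Γ) Δ E alg Sg' using (_⊩_; Φ; rule-derivable; at-ρy; at-ρz)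
    open SoundnessΣ L Γ Δ E alg Sg' using (True; eval-Δ; Φ-true⇒Sat; Sat⇒Φ-true)
    private
      module Sound = SoundnessΣ L Γ Δ E alg Sg
      A∈𝒬 : ModQ Γ (reduct A)
      A∈𝒬 = proj₁ A∈𝒬Σ

    sound-in-A^T : ∀ {Θ ψ} → Θ ⊩ ψ → ∀ ρ → (∀ θ → Θ θ → True (A ^ T) ρ θ) → True (A ^ T) ρ ψ
    sound-in-A^T {ψ = ψ} d ρ Θ-true =
      designated-cong (reduct A) (eval-trans A T ρ ψ) (Sound.⊩-sound A A∈𝒬Σ (T-morphism _ _ d) ρ hyps)
      where
      hyps : ∀ θ → image (trans T) _ θ → Sound.True A ρ θ
      hyps _ (θ , θ∈Θ , refl) = designated-cong (reduct A) (≈-sym (eval-trans A T ρ θ)) (Θ-true θ θ∈Θ)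

    -- m ≥ 1 provides an output to pad assignments with
    some-output : (φ : EFD τ) → Fin (m φ)
    some-output φ = fromℕ< (m≥1 φ)

    -- E_Σ': by the translated existence rules, T(f^φ)(ā) solves α_φ(ā, ·)
    A^T⊨E : ∀ φ (p : Sg' φ) a → SatEFD (reduct (A ^ T)) φ a (λ j → Algebra.⟦_⟧ (A ^ T) (inj₂ (φ , p , j)) a)
    A^T⊨E φ p a = Φ-true⇒Sat (A ^ T) A∈𝒬 φ ρ (ρf L Δ Sg' φ p) a fa ρρf≈ Φ-true
      where
      fa : Fin (m φ) → Carrier
      fa j = eval A a (T (φ , p , j))
      ρ : ℕ → Carrier
      ρ = extend (n φ) a (const (fa (some-output φ)))
      ρρf≈ : ∀ x → eval (A ^ T) ρ (ρf L Δ Sg' φ p x) ≈ [ a , fa ] x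
      ρρf≈ (inj₁ i) = ≡⇒≈ A (extend-toℕ (n φ) a _ i)
      ρρf≈ (inj₂ j) = eval-cong A (λ i → ≡⇒≈ A (≡-trans (eval*-tabulate (A ^ T) ρ _ i) (extend-toℕ (n φ) a _ i))) (T (φ , p , j))
      Φ-true : ∀ χ → χ ∈ Φ φ (ρf L Δ Sg' φ p) → True (A ^ T) ρ χ
      Φ-true χ χ∈ = sound-in-A^T (rule-derivable (exist φ p χ∈)) ρ (λ _ ())

    -- U_Σ': by the translated uniqueness rules, evaluated at x̄ ↦ ā, ȳ ↦ c̄, z̄ ↦ c̄'
    A^T⊨U : ∀ φ → Sg' φ → ∀ a c c' → SatEFD (reduct (A ^ T)) φ a c → SatEFD (reduct (A ^ T)) φ a c' →
            ∀ j → c j ≈ c' j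
    A^T⊨U φ p a c c' sat sat' j =
      subst₂ _≈_ (extend₃-y (n φ) (m φ) a c c' (c j) j) (extend₃-z (n φ) (m φ) a c c' (c j) j)
             (Δ-designated⇒≈ (reduct A) A∈𝒬 Δ-true)
      where
      ρ : ℕ → Carrier
      ρ = extend₃ (n φ) (m φ) a c c' (c j)
      premises-true : ∀ q → q ∈ Φ φ (ρy L Δ Sg' φ) ++ Φ φ (ρz L Δ Sg' φ) → True (A ^ T) ρ q
      premises-true q q∈ with ∈-++⁻ (Φ φ (ρy L Δ Sg' φ)) q∈
      ... | inj₁ q∈y = Sat⇒Φ-true (A ^ T) A∈𝒬 φ ρ _ a c (≡⇒≈ A ∘ at-ρy φ a c c' (c j) (eval (A ^ T) ρ) (λ _ → refl)) sat q q∈y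
      ... | inj₂ q∈z = Sat⇒Φ-true (A ^ T) A∈𝒬 φ ρ _ a c' (≡⇒≈ A ∘ at-ρz φ a c c' (c j) (eval (A ^ T) ρ) (λ _ → refl)) sat' q q∈z
      Δ-true : ∀ δ → δ ∈ Δ → Designated (reduct A) (eval (reduct A) (pair (ρ (n φ + toℕ j)) (ρ (n φ + m φ + toℕ j))) δ)
      Δ-true δ δ∈Δ = designated-cong (reduct A) (eval-Δ (A ^ T) ρ _ _ δ)
        (sound-in-A^T (rule-derivable (unique φ p j (∈-map⁺ (sub (pair (yv L Δ Sg' φ j) (zv L Δ Sg' φ j)) ∘ emb) δ∈Δ)))
                      ρ premises-true)

    A^T∈QΣ' : QΣ Γ Sg' (A ^ T)
    A^T∈QΣ' = A∈𝒬 , A^T⊨E , A^T⊨U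

  morphism⇒interpretation : ∀ Sg Sg' (T : Translation (ExpΣ Sg') (ExpΣ Sg)) →
                            IsMorphism T (_⊢Σ_ L Δ Sg') (_⊢Σ_ L Δ Sg) → IsInterpretation T (QΣ Γ Sg') (QΣ Γ Sg)
  morphism⇒interpretation Sg Sg' T T-morphism A A∈𝒬Σ = MorphismInterprets.A^T∈QΣ' Sg Sg' T T-morphism A A∈𝒬Σ

  -- (iii) ⇒ (i): the Lindenbaum algebra of L^Σ freely generated by x̄ lies
  -- in 𝒬 ∩ Mod(Σ) ⊆ Mod(Σ'), so α_φ(x̄, ·) has a solution there: Σ-terms
  -- t₁(x̄) … tₘ(x̄).  T sends f^φⱼ to tⱼ, and the translated rules of L^Σ'
  -- are derivable in L^Σ (uniqueness again by Mod(Σ'), now in the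
  -- Lindenbaum algebra of arbitrary premises Θ).
  module InclusionDefines (Sg Sg' : Pred (EFD τ) 0ℓ) (inc : QMod Γ Sg ⊆K QMod Γ Sg') where

    open DerivationsΣ L (ModQ Γ) Δ E alg Sg
    private
      module D' = DerivationsΣ L (ModQ Γ) Δ E alg Sg'

    -- the Lindenbaum algebra of theorems of L^Σ generated by x₀ … x_{n-1}
    module Free (φ : EFD τ) = Lindenbaum L Γ Δ E alg Sg (Fin (n φ)) (λ i → var (toℕ i)) (λ _ → ⊥)

    free⊨Σ' : ∀ φ → Sg' φ → reduct (Free.𝐋 φ) ⊨EFD φ
    free⊨Σ' φ p = proj₂ (inc (reduct (Free.𝐋 φ)) (QΣ⇒QMod Sg (Free.𝐋 φ) (Free.𝐋∈𝒬Σ φ))) φ p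

    T : Translation (ExpΣ Sg') (ExpΣ Sg)
    T (φ , p , j) = proj₁ (free⊨Σ' φ p var) j

    T-solves : ∀ φ (p : Sg' φ) → SatEFD (reduct (Free.𝐋 φ)) φ var (λ j → T (φ , p , j))
    T-solves φ p = proj₁ (proj₂ (free⊨Σ' φ p var))

    trans-Φ-instance : ∀ {Y : Set} (π₀ : Y → Fm D'.S) (e : Eqn τ Y) δ →
                       trans T (D'.Φ-instance π₀ e δ) ≡ Φ-instance (trans T ∘ π₀) e δ
    trans-Φ-instance π₀ e δ = ≡-trans (trans-sub-pair T _ _ δ)
      (cong₂ (λ u v → sub (pair u v) (emb δ)) (trans-sub-emb T π₀ (proj₁ e)) (trans-sub-emb T π₀ (proj₂ e)))

    translated-Φ : ∀ φ {Θ} (σ : ℕ → Fm S) π₀ → (∀ q → q ∈ D'.Φ φ π₀ → Θ ⊩ sub σ (trans T q)) →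
                   Solves {Θ} φ (sub σ ∘ trans T ∘ π₀)
    translated-Φ φ {Θ} σ π₀ premises e e∈ δ δ∈Δ =
      subst (Θ ⊩_) (≡-trans (cong (sub σ) (trans-Φ-instance π₀ e δ)) (sub-Φ-instance σ (trans T ∘ π₀) _ (λ _ → refl) e δ))
            (premises _ (D'.Φ-∈⁺ φ π₀ e∈ δ∈Δ))

    translated-exist : ∀ φ (p : Sg' φ) {χ} → χ ∈ D'.Φ φ (ρf L Δ Sg' φ p) → (λ _ → ⊥) ⊩ trans T χ
    translated-exist φ p χ∈ with D'.Φ-∈⁻ φ (ρf L Δ Sg' φ p) χ∈
    ... | e , e∈ , δ , δ∈Δ , refl =
      subst ((λ _ → ⊥) ⊩_) (≡-sym (trans-Φ-instance (ρf L Δ Sg' φ p) e δ))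
            (Solves-resp φ T∘ρf (Free.Sat⇒Solves φ φ var _ (T-solves φ p)) e e∈ δ δ∈Δ)
      where
      T∘ρf : ∀ x → [ (λ i → var (toℕ i)) , (λ j → sub (λ i → var (toℕ i)) (T (φ , p , j))) ] x ≡ trans T (ρf L Δ Sg' φ p x)
      T∘ρf (inj₁ i) = refl
      T∘ρf (inj₂ j) = sub-cong (λ i → ≡-sym (≡-trans (lookup-trans* T (tabulate _) i) (cong (trans T) (lookup∘tabulate _ i))))
                               (T (φ , p , j))

    translated-unique : ∀ φ (p : Sg' φ) j {Θ} (σ : ℕ → Fm S) →
                        (∀ q → q ∈ D'.Φ φ (ρy L Δ Sg' φ) ++ D'.Φ φ (ρz L Δ Sg' φ) → Θ ⊩ sub σ (trans T q)) →
                        ∀ {χ} → χ ∈ ΔΣ⟨_,_⟩ L Δ Sg' (yv L Δ Sg' φ j) (zv L Δ Sg' φ j) → Θ ⊩ sub σ (trans T χ)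
    translated-unique φ p j {Θ} σ premises χ∈ with ∈-map⁻ (sub (pair (yv L Δ Sg' φ j) (zv L Δ Sg' φ j)) ∘ emb) χ∈
    ... | δ , δ∈Δ , refl =
      subst (Θ ⊩_) (≡-sym (≡-trans (cong (sub σ) (trans-sub-pair T _ _ δ)) (sub-pair σ _ _ (emb δ)))) (y~z δ δ∈Δ)
      where
      module 𝐋Θ = Lindenbaum L Γ Δ E alg Sg ℕ σ Θ
      a : Fin (n φ) → Fm S
      a i = var (toℕ i)
      cy cz : Fin (m φ) → Fm S
      cy k = var (n φ + toℕ k)
      cz k = var (n φ + m φ + toℕ k)
      at-y : ∀ x → sub σ (trans T (ρy L Δ Sg' φ x)) ≡ [ sub σ ∘ a , sub σ ∘ cy ] x
      at-y (inj₁ _) = refl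
      at-y (inj₂ _) = refl
      at-z : ∀ x → sub σ (trans T (ρz L Δ Sg' φ x)) ≡ [ sub σ ∘ a , sub σ ∘ cz ] x
      at-z (inj₁ _) = refl
      at-z (inj₂ _) = refl
      sat-y : SatEFD (reduct 𝐋Θ.𝐋) φ a cy
      sat-y = 𝐋Θ.Solves⇒Sat φ a cy (Solves-resp φ at-y (translated-Φ φ σ _ (λ q q∈ → premises q (∈-++⁺ˡ q∈))))
      sat-z : SatEFD (reduct 𝐋Θ.𝐋) φ a cz
      sat-z = 𝐋Θ.Solves⇒Sat φ a cz
                (Solves-resp φ at-z (translated-Φ φ σ _ (λ q q∈ → premises q (∈-++⁺ʳ (D'.Φ φ (ρy L Δ Sg' φ)) q∈))))
      y~z : σ (n φ + toℕ j) ~[ Θ ] σ (n φ + m φ + toℕ j)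
      y~z = ⊨EFD⇒unique (reduct 𝐋Θ.𝐋) φ (proj₂ (inc (reduct 𝐋Θ.𝐋) (QΣ⇒QMod Sg 𝐋Θ.𝐋 𝐋Θ.𝐋∈𝒬Σ)) φ p) a cy cz sat-y sat-z j

    translated-rule : ∀ {ps c} → RuleΣ L Δ Sg' ps c → ∀ Θ (σ : ℕ → Fm S) →
                      (∀ q → q ∈ ps → Θ ⊩ sub σ (trans T q)) → Θ ⊩ sub σ (trans T c)
    translated-rule (base ps₀ c₀ d) Θ σ premises =
      subst (λ z → Θ ⊩ sub σ z) (≡-sym (trans-emb T c₀)) (L-rule d σ premises')
      where
      premises' : ∀ p → p ∈ ps₀ → Θ ⊩ sub σ (emb p)
      premises' p p∈ = subst (λ z → Θ ⊩ sub σ z) (trans-emb T p) (premises (emb p) (∈-map⁺ emb p∈))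
    translated-rule (exist φ p χ∈)     Θ σ _        = ⊩-subst σ (λ _ ()) (translated-exist φ p χ∈)
    translated-rule (unique φ p j χ∈)  Θ σ premises = translated-unique φ p j σ premises χ∈

    mutual
      T-morphism : IsMorphism T (_⊢Σ_ L Δ Sg') (_⊢Σ_ L Δ Sg)
      T-morphism Θ φ (hyp φ∈Θ) = hyp (φ , φ∈Θ , refl)
      T-morphism Θ _ (rule {c = c} r σ premises) =
        subst (image (trans T) Θ ⊩_) (≡-sym (trans-sub T σ c))
          (translated-rule r (image (trans T) Θ) (trans T ∘ σ) λ q q∈ →
             subst (image (trans T) Θ ⊩_) (trans-sub T σ q) (T-morphism* Θ premises q∈))

      T-morphism* : ∀ Θ {ps σ} → All (λ q → Θ D'.⊩ sub σ q) ps → ∀ {q} → q ∈ ps → image (trans T) Θ ⊩ trans T (sub σ q)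
      T-morphism* Θ (d ∷ ds) (here refl) = T-morphism Θ _ d
      T-morphism* Θ (d ∷ ds) (there q∈)  = T-morphism* Θ ds q∈

  inclusion⇒morphism : ∀ Sg Sg' → QMod Γ Sg ⊆K QMod Γ Sg' →
                       Σ[ T ∈ Translation (ExpΣ Sg') (ExpΣ Sg) ] IsMorphism T (_⊢Σ_ L Δ Sg') (_⊢Σ_ L Δ Sg)
  inclusion⇒morphism Sg Sg' inc = T , T-morphism
    where open InclusionDefines Sg Sg' inc

  inclusion⇒interpretation : ∀ Sg Sg' → QMod Γ Sg ⊆K QMod Γ Sg' →
                             Σ[ T ∈ Translation (ExpΣ Sg') (ExpΣ Sg) ] IsInterpretation T (QΣ Γ Sg') (QΣ Γ Sg)
  inclusion⇒interpretation Sg Sg' inc =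
    proj₁ (inclusion⇒morphism Sg Sg' inc) , morphism⇒interpretation Sg Sg' _ (proj₂ (inclusion⇒morphism Sg Sg' inc))

  -- Interpretations in both directions are mutually inverse: the new
  -- operations of (A^T)^S and of A both solve α_φ, hence agree by U_Σ.
  interpretations-inverse : ∀ Sg₁ Sg₂ (T : Translation (ExpΣ Sg₂) (ExpΣ Sg₁)) (S : Translation (ExpΣ Sg₁) (ExpΣ Sg₂)) →
                            IsInterpretation T (QΣ Γ Sg₂) (QΣ Γ Sg₁) → IsInterpretation S (QΣ Γ Sg₁) (QΣ Γ Sg₂) →
                            ∀ A → QΣ Γ Sg₁ A → IsInverseOn T S A
  interpretations-inverse Sg₁ Sg₂ T S T-interprets S-interprets A A∈𝒬Σ (inj₁ f) as =
    IsEquivalence.refl (Algebra.isEquiv A)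
  interpretations-inverse Sg₁ Sg₂ T S T-interprets S-interprets A A∈𝒬Σ@(_ , A⊨E , A⊨U) (inj₂ (φ , p , j)) as =
    A⊨U φ p as _ _ (proj₁ (proj₂ (S-interprets (A ^ T) (T-interprets A A∈𝒬Σ))) φ p as) (A⊨E φ p as) j

  -- If S ∘ T is the identity on 𝒬^Σ', then φ and S(T(φ)) are
  -- interderivable in L^Σ': they are equal in the Lindenbaum algebra of
  -- theorems, which lies in 𝒬^Σ'.
  inverse⇒interderivable : ∀ Sg Sg' (T : Translation (ExpΣ Sg') (ExpΣ Sg)) (S : Translation (ExpΣ Sg) (ExpΣ Sg')) →
                           (∀ B → QΣ Γ Sg' B → IsInverseOn S T B) →
                           ∀ φ → _⊢Σ_ L Δ Sg' ｛ φ ｝ (trans S (trans T φ)) × _⊢Σ_ L Δ Sg' ｛ trans S (trans T φ) ｝ φ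
  inverse⇒interderivable Sg Sg' T S inverse φ = ~⇒derivable (~-sym STφ~φ) , ~⇒derivable STφ~φ
    where
    open DerivationsΣ L (ModQ Γ) Δ E alg Sg' using (_~[_]_; ~-sym; ~-resp; ~⇒derivable)
    open Lindenbaum L Γ Δ E alg Sg' ℕ var (λ _ → ⊥) using (𝐋; 𝐋∈𝒬Σ; eval-𝐋)
    open Algebra 𝐋 using (_≈_)
    open IsEquivalence (Algebra.isEquiv 𝐋) renaming (trans to ≈-trans)
    eval-var : ∀ t → sub var (eval 𝐋 var t) ≡ t
    eval-var t = ≡-trans (sub-var _) (≡-trans (eval-𝐋 var t) (sub-var t))
    in-𝐋 : eval 𝐋 var (trans S (trans T φ)) ≈ eval 𝐋 var φ
    in-𝐋 = ≈-trans {eval 𝐋 var (trans S (trans T φ))} {eval (𝐋 ^ S) var (trans T φ)} {eval 𝐋 var φ}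
             (eval-trans 𝐋 S var (trans T φ))
             (≈-trans {eval (𝐋 ^ S) var (trans T φ)} {eval ((𝐋 ^ S) ^ T) var φ} {eval 𝐋 var φ}
                (eval-trans (𝐋 ^ S) T var φ) (eval-inverse 𝐋 S T (inverse 𝐋 𝐋∈𝒬Σ) var φ))
    STφ~φ : trans S (trans T φ) ~[ (λ _ → ⊥) ] φ
    STφ~φ = ~-resp (eval-var _) (eval-var φ) in-𝐋

  module _ (Sg Sg' : Pred (EFD τ) 0ℓ) where
    Inclusions : Set₁
    Inclusions = (QMod Γ Sg ⊆K QMod Γ Sg') × (QMod Γ Sg' ⊆K QMod Γ Sg)

    inclusions⇒term-equivalent : Inclusions → TermEquivalent {E₁ = ExpΣ Sg'} {E₂ = ExpΣ Sg} (QΣ Γ Sg') (QΣ Γ Sg)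
    inclusions⇒term-equivalent (inc , inc') =
      T , S , T-int , S-int , interpretations-inverse Sg Sg' T S T-int S-int , interpretations-inverse Sg' Sg S T S-int T-int
      where
      T : Translation (ExpΣ Sg') (ExpΣ Sg)
      T = proj₁ (inclusion⇒interpretation Sg Sg' inc)
      T-int : IsInterpretation T (QΣ Γ Sg') (QΣ Γ Sg)
      T-int = proj₂ (inclusion⇒interpretation Sg Sg' inc)
      S : Translation (ExpΣ Sg) (ExpΣ Sg')
      S = proj₁ (inclusion⇒interpretation Sg' Sg inc')
      S-int : IsInterpretation S (QΣ Γ Sg) (QΣ Γ Sg')
      S-int = proj₂ (inclusion⇒interpretation Sg' Sg inc')

    inclusions⇒equipollent : Inclusions → Equipollent {E₁ = ExpΣ Sg'} {E₂ = ExpΣ Sg} (_⊢Σ_ L Δ Sg') (_⊢Σ_ L Δ Sg)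
    inclusions⇒equipollent (inc , inc') =
      T , S , T-mor , S-mor ,
      inverse⇒interderivable Sg Sg' T S (interpretations-inverse Sg' Sg S T S-int T-int) ,
      inverse⇒interderivable Sg' Sg S T (interpretations-inverse Sg Sg' T S T-int S-int)
      where
      T : Translation (ExpΣ Sg') (ExpΣ Sg)
      T = proj₁ (inclusion⇒morphism Sg Sg' inc)
      T-mor : IsMorphism T (_⊢Σ_ L Δ Sg') (_⊢Σ_ L Δ Sg)
      T-mor = proj₂ (inclusion⇒morphism Sg Sg' inc)
      S : Translation (ExpΣ Sg) (ExpΣ Sg')
      S = proj₁ (inclusion⇒morphism Sg' Sg inc')
      S-mor : IsMorphism S (_⊢Σ_ L Δ Sg) (_⊢Σ_ L Δ Sg')
      S-mor = proj₂ (inclusion⇒morphism Sg' Sg inc')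
      T-int : IsInterpretation T (QΣ Γ Sg') (QΣ Γ Sg)
      T-int = morphism⇒interpretation Sg Sg' T T-mor
      S-int : IsInterpretation S (QΣ Γ Sg) (QΣ Γ Sg')
      S-int = morphism⇒interpretation Sg' Sg S S-mor

    term-equivalent⇒inclusions : TermEquivalent {E₁ = ExpΣ Sg'} {E₂ = ExpΣ Sg} (QΣ Γ Sg') (QΣ Γ Sg) → Inclusions
    term-equivalent⇒inclusions (T , S , T-int , S-int , _) =
      interpretation⇒inclusion Sg Sg' T T-int , interpretation⇒inclusion Sg' Sg S S-int

    equipollent⇒inclusions : Equipollent {E₁ = ExpΣ Sg'} {E₂ = ExpΣ Sg} (_⊢Σ_ L Δ Sg') (_⊢Σ_ L Δ Sg) → Inclusions
    equipollent⇒inclusions (T , S , T-mor , S-mor , _) =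
      interpretation⇒inclusion Sg Sg' T (morphism⇒interpretation Sg Sg' T T-mor) ,
      interpretation⇒inclusion Sg' Sg S (morphism⇒interpretation Sg' Sg S S-mor)

theorem3p2 : ∀ {τ : Signature} (L : Logic τ) (Γ : Pred (QuasiId τ) 0ℓ)
    (Δ : List (Term τ (Fin 2))) (E : Pred (Eqn τ (Fin 1)) 0ℓ) →
    IsAlgebraizable L (ModQ Γ) Δ E →
    (Sg Sg' : Pred (EFD τ) 0ℓ) →
    (((Σ[ T ∈ Translation (ExpΣ Sg') (ExpΣ Sg) ] IsMorphism T (_⊢Σ_ L Δ Sg') (_⊢Σ_ L Δ Sg))
        ⇔ (Σ[ T ∈ Translation (ExpΣ Sg') (ExpΣ Sg) ] IsInterpretation T (QΣ Γ Sg') (QΣ Γ Sg)))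
     × ((Σ[ T ∈ Translation (ExpΣ Sg') (ExpΣ Sg) ] IsInterpretation T (QΣ Γ Sg') (QΣ Γ Sg))
        ⇔ (QMod Γ Sg ⊆K QMod Γ Sg')))
    ×
    ((Equipollent {E₁ = ExpΣ Sg'} {E₂ = ExpΣ Sg} (_⊢Σ_ L Δ Sg') (_⊢Σ_ L Δ Sg)
        ⇔ TermEquivalent {E₁ = ExpΣ Sg'} {E₂ = ExpΣ Sg} (QΣ Γ Sg') (QΣ Γ Sg))
     × (TermEquivalent {E₁ = ExpΣ Sg'} {E₂ = ExpΣ Sg} (QΣ Γ Sg') (QΣ Γ Sg)
        ⇔ ((QMod Γ Sg ⊆K QMod Γ Sg') × (QMod Γ Sg' ⊆K QMod Γ Sg))))
theorem3p2 L Γ Δ E alg Sg Sg' =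
  ( mk⇔ (λ { (T , T-mor) → T , morphism⇒interpretation Sg Sg' T T-mor })
        (λ { (T , T-int) → inclusion⇒morphism Sg Sg' (interpretation⇒inclusion Sg Sg' T T-int) })
  , mk⇔ (λ { (T , T-int) → interpretation⇒inclusion Sg Sg' T T-int })
        (inclusion⇒interpretation Sg Sg') )
  , ( mk⇔ (inclusions⇒term-equivalent Sg Sg' ∘ equipollent⇒inclusions Sg Sg')
          (inclusions⇒equipollent Sg Sg' ∘ term-equivalent⇒inclusions Sg Sg')
    , mk⇔ (term-equivalent⇒inclusions Sg Sg') (inclusions⇒term-equivalent Sg Sg') )
  where open Correspondence L Γ Δ E alg
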